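{- Let $P$ be an integer such that $P^2+4$ is square-free, let $m\ge 0$ be an integer, and let $\sigma_2(n)=\sum_{d\mid n} d^2$ (sum over positive divisors). Then, apart from finitely many (computable) solutions, all of which satisfy $n\le \big(|V_{2m}(P,-1)|+V_{2m}^2(P,-1)-5\big)^3$, every positive integer solution $n$ of $$\sigma_2(n)-n^2=V_{2m}(P,-1)\,n-V_{2m}^2(P,-1)+5$$ is of one of the following forms: (1) $n=V_{2k}(P,-1)\,V_{2k+2m}(P,-1)$ for some integer $k\ge 0$, with $V_{2k}(P,-1)$ and $V_{2k+2m}(P,-1)$ both primes; (2) $n=V_{2k}(P,-1)\,V_{2m-2k}(P,-1)$ for some integer $k\ge 0$ with $2m-2k\ge 0$ and $m\neq 2k$, with $V_{2k}(P,-1)$ and $V_{2m-2k}(P,-1)$ both primes.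
   Context: For integers $P,Q$, the Lucas sequence of the first kind is defined by $U_0(P,Q)=0$, $U_1(P,Q)=1$, $U_n(P,Q)=P\,U_{n-1}(P,Q)-Q\,U_{n-2}(P,Q)$ for $n>1$. The Lucas sequence of the second kind is $V_0(P,Q)=2$, $V_1(P,Q)=P$, $V_n(P,Q)=P\,V_{n-1}(P,Q)-Q\,V_{n-2}(P,Q)$ for $n>1$. -}

module Defs where

open import Data.Nat as ℕ using (ℕ; zero; suc)
open import Data.Nat.Divisibility using (_∣_; _∣?_)
open import Data.Nat.Primality using (Prime)
open import Data.Integer as ℤ using (ℤ; +_)
open import Data.List using (List; filter; map; upTo)
open import Data.Nat.ListAction using (sum)
open import Data.Product using (Σ; _×_)
open import Relation.Binary.PropositionalEquality using (_≡_)

V : ℤ → ℤ → ℕ → ℤ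
V P Q zero = + 2
V P Q (suc zero) = P
V P Q (suc (suc n)) = P ℤ.* V P Q (suc n) ℤ.- Q ℤ.* V P Q n

U : ℤ → ℤ → ℕ → ℤ
U P Q zero = + 0
U P Q (suc zero) = + 1
U P Q (suc (suc n)) = P ℤ.* U P Q (suc n) ℤ.- Q ℤ.* U P Q n

divisors : ℕ → List ℕ
divisors n = filter (_∣? n) (map suc (upTo n))

σ₂ : ℕ → ℕ
σ₂ n = sum (map (λ d → d ℕ.* d) (divisors n))

SquareFree : ℤ → Set
SquareFree z = ∀ (d : ℕ) → (d ℕ.* d) ∣ ℤ.∣ z ∣ → d ≡ 1

IsPrime : ℤ → Set
IsPrime z = Σ ℕ (λ p → (z ≡ + p) × Prime p)

{-# OPTIONS --safe #-}
-- Let p = |P|, D = p² + 4 and w = V_{2m}(P, -1) = V_{2m}(p, -1) ≥ 2. If n = b q with q the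
-- least prime factor of n and q < b, the divisors 1, q, b, n already give
-- 1 + q² + b² + w² ≤ w n + 5, which bounds n by w³ unless b is prime; n prime or n = q²
-- are bounded directly. For b prime the equation is exactly the Markov-type equation
-- q² + b² + w² = q b w + 4. Viewed as a quadratic in b its discriminant (q² - 4)(w² - 4)
-- is a square, and w² - 4 = D U_{2m}², so square-freeness of D gives q² - 4 = D s²; descent
-- on the Pell equations x² - D t² = ±4 then shows q = V_{2a}. By the addition formula the
-- quadratic has the roots V_{2a+2m} and V_{2|a-m|}, so b is one of them.
module Submission where

open import Defs
open import Data.Nat as ℕ using (ℕ; zero; suc; _+_; _*_; _∸_; _^_; ∣_-_∣; _≤_; _<_; _≟_; z≤n; s≤s; NonZero)
open import Data.Nat.Properties
open import Data.Nat.Tactic.RingSolver using (solve-∀)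
open import Data.Nat.Divisibility
open import Data.Nat.GCD using (gcd; gcd[m,n]∣m; gcd[m,n]∣n; gcd[m,n]≢0; gcd-greatest)
open import Data.Nat.Coprimality using (Coprime; coprime-divisor)
import Data.Integer as ℤ
open import Data.Nat.Primality using (Prime; prime; Composite; _Rough_; composite?; prime[2]; euclidsLemma; prime⇒nonTrivial; prime⇒nonZero;
  prime⇒irreducible; 2-rough; rough⇒≤; ∤⇒rough-suc; rough∧∣⇒rough; rough∧∣⇒prime)
open import Data.Nat.Induction using (<-rec)
open import Data.Nat.ListAction using (sum)
open import Data.Nat.ListAction.Properties using (sum-++)
open import Data.List using (List; []; _∷_; [_]; _++_; map; filter; upTo)
open import Data.List.Properties using (map-++; upTo-∷ʳ)
open import Data.List.Membership.Propositional using (_∈_; _∉_)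
open import Data.List.Membership.DecPropositional _≟_ using (_∈?_)
open import Data.List.Relation.Unary.Any using (here; there)
open import Data.List.Relation.Unary.All as All using (All; []; _∷_)
open import Data.List.Relation.Unary.Linked using (Linked; [-]; _∷_)
open import Data.List.Relation.Unary.Linked.Properties using (Linked⇒AllPairs)
open import Data.List.Relation.Unary.AllPairs as AllPairs using ([]; _∷_)
open import Data.List.Relation.Unary.Unique.Propositional using (Unique)
open import Data.Product using (Σ; ∃; _×_; _,_; proj₁; proj₂)
open import Data.Sum using (_⊎_; inj₁; inj₂; [_,_]′)
open import Data.Empty using (⊥; ⊥-elim)
open import Function using (_∘_; _$_)
open import Relation.Binary.PropositionalEquality hiding ([_])
open import Relation.Nullary using (Dec; yes; no)

≤∧sq+sq≡2*prod⇒≡ : ∀ {a b} → a ≤ b → a * a + b * b ≡ 2 * a * b → a ≡ b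
≤∧sq+sq≡2*prod⇒≡ {a} {b} a≤b e = trans (sym (+-identityʳ a)) (trans (cong (a +_) (sym k≡0)) (m+[n∸m]≡n a≤b))
  where
  k = b ∸ a
  expand : ∀ a k → k * k + 2 * a * (a + k) ≡ a * a + (a + k) * (a + k)
  expand = solve-∀
  k*k≡0 : k * k ≡ 0
  k*k≡0 = +-cancelʳ-≡ (2 * a * (a + k)) _ _ (trans (expand a k)
            (subst (λ c → a * a + c * c ≡ 2 * a * c) (sym (m+[n∸m]≡n a≤b)) e))
  k≡0 : k ≡ 0
  k≡0 with m*n≡0⇒m≡0∨n≡0 k k*k≡0
  ... | inj₁ k≡0 = k≡0
  ... | inj₂ k≡0 = k≡0

sq+sq≡2*prod⇒≡ : ∀ a b → a * a + b * b ≡ 2 * a * b → a ≡ b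
sq+sq≡2*prod⇒≡ a b e with ≤-total a b
... | inj₁ a≤b = ≤∧sq+sq≡2*prod⇒≡ a≤b e
... | inj₂ b≤a = sym (≤∧sq+sq≡2*prod⇒≡ b≤a (trans (+-comm (b * b) (a * a)) (trans e (swap a b))))
  where
  swap : ∀ a b → 2 * a * b ≡ 2 * b * a
  swap = solve-∀

≤∧square-of-difference : ∀ {a b} → a ≤ b → ∃ λ z → z * z + 2 * a * b ≡ a * a + b * b
≤∧square-of-difference {a} {b} a≤b = b ∸ a , subst (λ c → (c ∸ a) * (c ∸ a) + 2 * a * c ≡ a * a + c * c)
  (m+[n∸m]≡n a≤b) (trans (cong (λ k → k * k + 2 * a * (a + (b ∸ a))) (m+n∸m≡n a (b ∸ a))) (expand a (b ∸ a)))
  where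
  expand : ∀ a k → k * k + 2 * a * (a + k) ≡ a * a + (a + k) * (a + k)
  expand = solve-∀

square-of-difference : ∀ a b → ∃ λ z → z * z + 2 * a * b ≡ a * a + b * b
square-of-difference a b with ≤-total a b
... | inj₁ a≤b = ≤∧square-of-difference a≤b
... | inj₂ b≤a with ≤∧square-of-difference b≤a
...   | z , e = z , trans (cong (z * z +_) (swap a b)) (trans e (+-comm (b * b) (a * a)))
  where
  swap : ∀ a b → 2 * a * b ≡ 2 * b * a
  swap = solve-∀

2*m*n≤m*m+n*n : ∀ m n → 2 * m * n ≤ m * m + n * n
2*m*n≤m*m+n*n m n = subst (2 * m * n ≤_) (proj₂ (square-of-difference m n)) (m≤n+m _ _)

∣m-n∣<m+n : ∀ {m n} → 1 ≤ m → 1 ≤ n → ∣ m - n ∣ < m + n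
∣m-n∣<m+n {m} {n} m≥1 n≥1 with ∣m-n∣≡[m∸n]∨[n∸m] m n
... | inj₁ e = subst (_< m + n) (sym e) (≤-<-trans (m∸n≤m m n) (m<m+n m n≥1))
... | inj₂ e = subst (_< m + n) (sym e) (≤-<-trans (m∸n≤m n m) (m<n+m n m≥1))

m*m≤n*n⇒m≤n : ∀ {m n} → m * m ≤ n * n → m ≤ n
m*m≤n*n⇒m≤n h = ≮⇒≥ λ n<m → <⇒≱ (*-mono-< n<m n<m) h

2∣m*m⇒2∣m : ∀ {m} → 2 ∣ m * m → 2 ∣ m
2∣m*m⇒2∣m {m} h with euclidsLemma m m prime[2] h
... | inj₁ 2∣m = 2∣m
... | inj₂ 2∣m = 2∣m

prime⇒≥2 : ∀ {n} → Prime n → 2 ≤ n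
prime⇒≥2 {n} pn = ℕ.nonTrivial⇒n>1 n {{prime⇒nonTrivial pn}}

-- The Markov-type equation x² + y² + z² = x y z + 4

record Markov (a b c : ℕ) : Set where
  constructor markov
  field equation : a * a + b * b + c * c ≡ a * b * c + 4

markov-swap₁₂ : ∀ {a b c} → Markov a b c → Markov b a c
markov-swap₁₂ {a} {b} {c} (markov e) = markov $ trans (sym (shuffle a b c)) (trans e (cong (_+ 4) (*-comm-prod a b c)))
  where
  shuffle : ∀ a b c → a * a + b * b + c * c ≡ b * b + a * a + c * c
  shuffle = solve-∀
  *-comm-prod : ∀ a b c → a * b * c ≡ b * a * c
  *-comm-prod = solve-∀

markov-swap₂₃ : ∀ {a b c} → Markov a b c → Markov a c b
markov-swap₂₃ {a} {b} {c} (markov e) = markov $ trans (sym (shuffle a b c)) (trans e (cong (_+ 4) (*-comm-prod a b c)))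
  where
  shuffle : ∀ a b c → a * a + b * b + c * c ≡ a * a + c * c + b * b
  shuffle = solve-∀
  *-comm-prod : ∀ a b c → a * b * c ≡ a * c * b
  *-comm-prod = solve-∀

-- Here (2z - xy)² = D² s² t² = (x² - 4)(y² - 4), which is 4 times the Markov equation.
markov-from-pell : ∀ D x y z s t → x * x ≡ D * s * s + 4 → y * y ≡ D * t * t + 4 →
                   2 * z ≡ x * y + D * s * t → Markov x y z
markov-from-pell D x y z s t hx hy hz = markov $ *-cancelˡ-≡ _ _ 4 (begin
  4 * (x * x + y * y + z * z)                                 ≡⟨ expand x y z ⟩
  4 * (x * x) + 4 * (y * y) + (2 * z) * (2 * z)               ≡⟨ cong (λ w → 4 * (x * x) + 4 * (y * y) + w * w) hz ⟩
  4 * (x * x) + 4 * (y * y) + (x * y + D * s * t) * (x * y + D * s * t)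
                                                              ≡⟨ key ⟩
  2 * (x * y) * (x * y + D * s * t) + 16                      ≡⟨ cong (λ w → 2 * (x * y) * w + 16) hz ⟨
  2 * (x * y) * (2 * z) + 16                                  ≡⟨ collect x y z ⟩
  4 * (x * y * z + 4)                                         ∎)
  where
  open ≡-Reasoning
  expand : ∀ x y z → 4 * (x * x + y * y + z * z) ≡ 4 * (x * x) + 4 * (y * y) + (2 * z) * (2 * z)
  expand = solve-∀
  collect : ∀ x y z → 2 * (x * y) * (2 * z) + 16 ≡ 4 * (x * y * z + 4)
  collect = solve-∀
  cross : 4 * (x * x) + 4 * (y * y) + D * D * s * s * t * t ≡ (x * x) * (y * y) + 16
  cross = subst₂ (λ X Y → 4 * X + 4 * Y + D * D * s * s * t * t ≡ X * Y + 16) (sym hx) (sym hy) (expand′ D s t)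
    where
    expand′ : ∀ D s t → 4 * (D * s * s + 4) + 4 * (D * t * t + 4) + D * D * s * s * t * t
                      ≡ (D * s * s + 4) * (D * t * t + 4) + 16
    expand′ = solve-∀
  polynomial : ∀ D x y s t → 4 * (x * x) + 4 * (y * y) + (x * y + D * s * t) * (x * y + D * s * t) + ((x * x) * (y * y) + 16)
                           ≡ 2 * (x * y) * (x * y + D * s * t) + 16 + (4 * (x * x) + 4 * (y * y) + D * D * s * s * t * t)
  polynomial = solve-∀
  key : 4 * (x * x) + 4 * (y * y) + (x * y + D * s * t) * (x * y + D * s * t) ≡ 2 * (x * y) * (x * y + D * s * t) + 16
  key = +-cancelʳ-≡ ((x * x) * (y * y) + 16) _ _
          (trans (polynomial D x y s t) (cong (2 * (x * y) * (x * y + D * s * t) + 16 +_) cross))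

markov-2⇒≡ : ∀ {y z} → Markov 2 y z → y ≡ z
markov-2⇒≡ {y} {z} (markov e) = sq+sq≡2*prod⇒≡ y z (+-cancelˡ-≡ 4 _ _ (trans (reshape y z) (trans e (+-comm (2 * y * z) 4))))
  where
  reshape : ∀ y z → 4 + (y * y + z * z) ≡ 2 * 2 + y * y + z * z
  reshape = solve-∀

markov-vieta-≤ : ∀ {x y r z} → y ≤ r → Markov x y z → Markov x r z → y ≡ r ⊎ y + r ≡ z * x
markov-vieta-≤ {x} {y} {r} {z} y≤r (markov hy) (markov hr) with r ∸ y | m+[n∸m]≡n y≤r
... | zero | refl = inj₁ (sym (+-identityʳ y))
... | k@(suc _) | refl = inj₂ (trans (sym (*-cancelˡ-≡ _ _ k root-sum)) (*-comm x z))
  where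
  lhs : ∀ x y k z → x * x + y * y + z * z + (2 * y * k + k * k) ≡ x * x + (y + k) * (y + k) + z * z
  lhs = solve-∀
  rhs : ∀ x y k z → x * (y + k) * z + 4 ≡ x * y * z + 4 + k * (x * z)
  rhs = solve-∀
  factor : ∀ y k → 2 * y * k + k * k ≡ k * (y + (y + k))
  factor = solve-∀
  root-sum : k * (x * z) ≡ k * (y + (y + k))
  root-sum = trans (sym (+-cancelˡ-≡ (x * x + y * y + z * z) _ _
    (trans (lhs x y k z) (trans hr (trans (rhs x y k z) (cong (_+ k * (x * z)) (sym hy))))))) (factor y k)

markov-vieta : ∀ {x y r z} → Markov x y z → Markov x r z → y ≡ r ⊎ y + r ≡ z * x
markov-vieta {y = y} {r} hy hr with ≤-total y r
... | inj₁ y≤r = markov-vieta-≤ y≤r hy hr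
... | inj₂ r≤y with markov-vieta-≤ r≤y hr hy
...   | inj₁ r≡y = inj₁ (sym r≡y)
...   | inj₂ e = inj₂ (trans (+-comm y r) e)

markov-two-roots : ∀ {x y r s z} → Markov x y z → Markov x r z → Markov x s z → r ≢ s → y ≡ r ⊎ y ≡ s
markov-two-roots {y = y} hy hr hs r≢s with markov-vieta hy hr | markov-vieta hy hs
... | inj₁ y≡r | _ = inj₁ y≡r
... | inj₂ _ | inj₁ y≡s = inj₂ y≡s
... | inj₂ e₁ | inj₂ e₂ = ⊥-elim (r≢s (+-cancelˡ-≡ y _ _ (trans e₁ (sym e₂))))

-- As a quadratic in y the equation has discriminant (x² - 4)(w² - 4), the square of z = |2y - wx|.
markov-discriminant : ∀ {x y w c d} → Markov x y w → x * x ≡ c + 4 → w * w ≡ d + 4 → ∃ λ z → d * c ≡ z * z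
markov-discriminant {x} {y} {w} {c} {d} (markov hM) hx hw = z , sym (+-cancelʳ-≡ (4 * (c + 4) + 4 * (d + 4)) _ _
  (trans (subst₂ (λ X V → z * z + (4 * X + 4 * V) ≡ V * X + 16) hx hw key) (expand d c)))
  where
  z = proj₁ (square-of-difference (2 * y) (w * x))
  identity : ∀ z x y w → z * z + (4 * (x * x) + 4 * (w * w)) + ((2 * y) * (2 * y) + (w * x) * (w * x) + 4 * (x * y * w + 4))
                       ≡ w * w * (x * x) + 16 + (z * z + 2 * (2 * y) * (w * x) + 4 * (x * x + y * y + w * w))
  identity = solve-∀
  key : z * z + (4 * (x * x) + 4 * (w * w)) ≡ w * w * (x * x) + 16
  key = +-cancelʳ-≡ _ _ _ (trans (identity z x y w)
          (cong₂ (λ A B → w * w * (x * x) + 16 + (A + 4 * B)) (proj₂ (square-of-difference (2 * y) (w * x))) hM))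
  expand : ∀ d c → (d + 4) * (c + 4) + 16 ≡ d * c + (4 * (c + 4) + 4 * (d + 4))
  expand = solve-∀

-- Lucas sequences of (p, -1) and the Pell equations x² - (p² + 4) t² = ±4

-- v n = V_n(p, -1) and u n = U_n(p, -1), computed in ℕ.
module Lucas (p : ℕ) where

  D : ℕ
  D = p * p + 4

  v : ℕ → ℕ
  v zero = 2
  v (suc zero) = p
  v (suc (suc n)) = p * v (suc n) + v n

  u : ℕ → ℕ
  u zero = 0
  u (suc zero) = 1
  u (suc (suc n)) = p * u (suc n) + u n

  LucasLike : (ℕ → ℕ) → Set
  LucasLike f = ∀ n → f (suc (suc n)) ≡ p * f (suc n) + f n

  lucasLike-ext : ∀ f g → LucasLike f → LucasLike g → f 0 ≡ g 0 → f 1 ≡ g 1 → ∀ n → f n ≡ g n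
  lucasLike-ext f g rf rg e₀ e₁ zero = e₀
  lucasLike-ext f g rf rg e₀ e₁ (suc zero) = e₁
  lucasLike-ext f g rf rg e₀ e₁ (suc (suc n)) = begin
    f (suc (suc n))          ≡⟨ rf n ⟩
    p * f (suc n) + f n      ≡⟨ cong₂ (λ a b → p * a + b) (lucasLike-ext f g rf rg e₀ e₁ (suc n))
                                                          (lucasLike-ext f g rf rg e₀ e₁ n) ⟩
    p * g (suc n) + g n      ≡⟨ rg n ⟨
    g (suc (suc n))          ∎
    where open ≡-Reasoning

  lucasLike-v : LucasLike v
  lucasLike-v n = refl

  lucasLike-u : LucasLike u
  lucasLike-u n = refl

  lucasLike-+ : ∀ {f g} → LucasLike f → LucasLike g → LucasLike (λ n → f n + g n)
  lucasLike-+ {f} {g} rf rg n = begin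
    f (suc (suc n)) + g (suc (suc n))             ≡⟨ cong₂ _+_ (rf n) (rg n) ⟩
    p * f (suc n) + f n + (p * g (suc n) + g n)   ≡⟨ regroup p (f (suc n)) (f n) (g (suc n)) (g n) ⟩
    p * (f (suc n) + g (suc n)) + (f n + g n)     ∎
    where
    open ≡-Reasoning
    regroup : ∀ p x y z w → p * x + y + (p * z + w) ≡ p * (x + z) + (y + w)
    regroup = solve-∀

  lucasLike-* : ∀ a {f} → LucasLike f → LucasLike (λ n → a * f n)
  lucasLike-* a {f} rf n = begin
    a * f (suc (suc n))          ≡⟨ cong (a *_) (rf n) ⟩
    a * (p * f (suc n) + f n)    ≡⟨ regroup p a (f (suc n)) (f n) ⟩
    p * (a * f (suc n)) + a * f n ∎
    where
    open ≡-Reasoning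
    regroup : ∀ p a x y → a * (p * x + y) ≡ p * (a * x) + a * y
    regroup = solve-∀

  double-v-suc : ∀ n → 2 * v (suc n) ≡ p * v n + D * u n
  double-v-suc = lucasLike-ext _ _ (lucasLike-* 2 (lucasLike-v ∘ suc))
    (lucasLike-+ (lucasLike-* p lucasLike-v) (lucasLike-* D lucasLike-u)) (at0 p) (at1 p)
    where
    at0 : ∀ p → 2 * p ≡ p * 2 + (p * p + 4) * 0
    at0 = solve-∀
    at1 : ∀ p → 2 * (p * p + 2) ≡ p * p + (p * p + 4) * 1
    at1 = solve-∀

  double-u-suc : ∀ n → 2 * u (suc n) ≡ v n + p * u n
  double-u-suc = lucasLike-ext _ _ (lucasLike-* 2 (lucasLike-u ∘ suc))
    (lucasLike-+ lucasLike-v (lucasLike-* p lucasLike-u)) (at0 p) (at1 p)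
    where
    at0 : ∀ p → 2 * 1 ≡ 2 + p * 0
    at0 = solve-∀
    at1 : ∀ p → 2 * (p * 1 + 0) ≡ p + p * 1
    at1 = solve-∀

  double-v-+ : ∀ i j → 2 * v (i + j) ≡ v i * v j + D * u i * u j
  double-v-+ i j = begin
    2 * v (i + j)               ≡⟨ cong (λ k → 2 * v k) (+-comm i j) ⟩
    2 * v (j + i)               ≡⟨ lucasLike-ext _ _ (lucasLike-* 2 {λ j → v (j + i)} (λ _ → refl))
                                     (lucasLike-+ (lucasLike-* (v i) lucasLike-v) (lucasLike-* (D * u i) lucasLike-u))
                                     (at0 (v i) (D * u i)) (trans (double-v-suc i) (at1 p (v i) D (u i))) j ⟩
    v i * v j + D * u i * u j   ∎
    where
    open ≡-Reasoning
    at0 : ∀ a b → 2 * a ≡ a * 2 + b * 0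
    at0 = solve-∀
    at1 : ∀ p a b c → p * a + b * c ≡ a * p + b * c * 1
    at1 = solve-∀

  sq-v-suc+sq-v : ∀ n → v (suc n) * v (suc n) + v n * v n ≡ D * (u (suc n) * u (suc n)) + D * (u n * u n)
  sq-v-suc+sq-v n = *-cancelˡ-≡ _ _ 4 (begin
    4 * (v (suc n) * v (suc n) + v n * v n)
      ≡⟨ expand (v (suc n)) (v n) ⟩
    (2 * v (suc n)) * (2 * v (suc n)) + 4 * (v n * v n)
      ≡⟨ cong (λ w → w * w + 4 * (v n * v n)) (double-v-suc n) ⟩
    (p * v n + D * u n) * (p * v n + D * u n) + 4 * (v n * v n)
      ≡⟨ key p (v n) (u n) ⟩
    D * ((v n + p * u n) * (v n + p * u n)) + 4 * (D * (u n * u n))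
      ≡⟨ cong (λ w → D * (w * w) + 4 * (D * (u n * u n))) (double-u-suc n) ⟨
    D * ((2 * u (suc n)) * (2 * u (suc n))) + 4 * (D * (u n * u n))
      ≡⟨ collect D (u (suc n)) (u n) ⟩
    4 * (D * (u (suc n) * u (suc n)) + D * (u n * u n)) ∎)
    where
    open ≡-Reasoning
    expand : ∀ a b → 4 * (a * a + b * b) ≡ (2 * a) * (2 * a) + 4 * (b * b)
    expand = solve-∀
    key : ∀ p a b → (p * a + (p * p + 4) * b) * (p * a + (p * p + 4) * b) + 4 * (a * a)
                  ≡ (p * p + 4) * ((a + p * b) * (a + p * b)) + 4 * ((p * p + 4) * (b * b))
    key = solve-∀
    collect : ∀ D a b → D * ((2 * a) * (2 * a)) + 4 * (D * (b * b)) ≡ 4 * (D * (a * a) + D * (b * b))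
    collect = solve-∀

  pell⁺⇒pell⁻-suc : ∀ n → v n * v n ≡ D * (u n * u n) + 4 → v (suc n) * v (suc n) + 4 ≡ D * (u (suc n) * u (suc n))
  pell⁺⇒pell⁻-suc n hyp = +-cancelʳ-≡ (v n * v n) _ _ (begin
    v (suc n) * v (suc n) + 4 + v n * v n           ≡⟨ swap (v (suc n) * v (suc n)) 4 (v n * v n) ⟩
    v (suc n) * v (suc n) + v n * v n + 4           ≡⟨ cong (_+ 4) (sq-v-suc+sq-v n) ⟩
    D * (u (suc n) * u (suc n)) + D * (u n * u n) + 4 ≡⟨ +-assoc (D * (u (suc n) * u (suc n))) _ 4 ⟩
    D * (u (suc n) * u (suc n)) + (D * (u n * u n) + 4) ≡⟨ cong (D * (u (suc n) * u (suc n)) +_) hyp ⟨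
    D * (u (suc n) * u (suc n)) + v n * v n         ∎)
    where
    open ≡-Reasoning
    swap : ∀ a b c → a + b + c ≡ a + c + b
    swap = solve-∀

  pell⁻⇒pell⁺-suc : ∀ n → v n * v n + 4 ≡ D * (u n * u n) → v (suc n) * v (suc n) ≡ D * (u (suc n) * u (suc n)) + 4
  pell⁻⇒pell⁺-suc n hyp = +-cancelʳ-≡ (D * (u n * u n)) _ _ (begin
    v (suc n) * v (suc n) + D * (u n * u n)         ≡⟨ cong (v (suc n) * v (suc n) +_) hyp ⟨
    v (suc n) * v (suc n) + (v n * v n + 4)         ≡⟨ +-assoc (v (suc n) * v (suc n)) _ 4 ⟨
    v (suc n) * v (suc n) + v n * v n + 4           ≡⟨ cong (_+ 4) (sq-v-suc+sq-v n) ⟩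
    D * (u (suc n) * u (suc n)) + D * (u n * u n) + 4 ≡⟨ swap (D * (u (suc n) * u (suc n))) (D * (u n * u n)) 4 ⟩
    D * (u (suc n) * u (suc n)) + 4 + D * (u n * u n) ∎)
    where
    open ≡-Reasoning
    swap : ∀ a b c → a + b + c ≡ a + c + b
    swap = solve-∀

  pell-v-even : ∀ j → v (2 * j) * v (2 * j) ≡ D * (u (2 * j) * u (2 * j)) + 4
  pell-v-even zero = at0 p
    where
    at0 : ∀ p → 2 * 2 ≡ (p * p + 4) * (0 * 0) + 4
    at0 = solve-∀
  pell-v-even (suc j) rewrite *-suc 2 j = pell⁻⇒pell⁺-suc (suc (2 * j)) (pell⁺⇒pell⁻-suc (2 * j) (pell-v-even j))

  markov-v-even : ∀ a b → Markov (v (2 * a)) (v (2 * b)) (v (2 * a + 2 * b))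
  markov-v-even a b = markov-from-pell D (v (2 * a)) (v (2 * b)) (v (2 * a + 2 * b)) (u (2 * a)) (u (2 * b))
    (pell-form a) (pell-form b) (double-v-+ (2 * a) (2 * b))
    where
    pell-form : ∀ j → v (2 * j) * v (2 * j) ≡ D * u (2 * j) * u (2 * j) + 4
    pell-form j = trans (pell-v-even j) (cong (_+ 4) (sym (*-assoc D _ _)))

  LucasProduct : ℕ → ℕ → Set
  LucasProduct m n =
      (∃ λ k → n ≡ v (2 * k) * v (2 * k + 2 * m) × Prime (v (2 * k)) × Prime (v (2 * k + 2 * m)))
    ⊎ (∃ λ k → 2 * k ≤ 2 * m × m ≢ 2 * k × n ≡ v (2 * k) * v (2 * m ∸ 2 * k)
             × Prime (v (2 * k)) × Prime (v (2 * m ∸ 2 * k)))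

  module Growth (p≥1 : 1 ≤ p) where

    v≥1 : ∀ n → 1 ≤ v n
    v≥1 zero = s≤s z≤n
    v≥1 (suc zero) = p≥1
    v≥1 (suc (suc n)) = ≤-trans (v≥1 n) (m≤n+m (v n) (p * v (suc n)))

    v<v-suc-suc : ∀ n → v n < v (suc (suc n))
    v<v-suc-suc n = +-monoˡ-≤ (v n) (*-mono-≤ p≥1 (v≥1 (suc n)))

    v-even-step : ∀ a → v (2 * a) < v (2 * suc a)
    v-even-step a rewrite *-suc 2 a = v<v-suc-suc (2 * a)

    v-even-strictMono : ∀ {a b} → a < b → v (2 * a) < v (2 * b)
    v-even-strictMono {a} {suc b} (s≤s a≤b) with m≤n⇒m<n∨m≡n a≤b
    ... | inj₁ a<b = <-trans (v-even-strictMono a<b) (v-even-step b)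
    ... | inj₂ refl = v-even-step a

    v-even≥2 : ∀ a → 2 ≤ v (2 * a)
    v-even≥2 zero = ≤-refl
    v-even≥2 (suc a) = <⇒≤ (≤-<-trans (v-even≥2 a) (v-even-step a))

    v-even-suc≥3 : ∀ a → 3 ≤ v (2 * suc a)
    v-even-suc≥3 a = ≤-<-trans (v-even≥2 a) (v-even-step a)

module Pell (p : ℕ) where
  open Lucas p

  -- x² - (p t)² = 4e forces x ≡ p t (mod 2).
  halve-gap : ∀ x t e → x * x ≡ (p * t) * (p * t) + 4 * e →
              ∃ λ t′ → x ≡ p * t + 2 * t′ × t′ * (p * t + t′) ≡ e
  halve-gap x t e h = halve (2∣m*m⇒2∣m (∣m+n∣m⇒∣n 2∣sum (divides (a * r) (*-comm 2 (a * r)))))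
    where
    a = p * t
    a≤x : a ≤ x
    a≤x = m*m≤n*n⇒m≤n (subst (a * a ≤_) (sym h) (m≤m+n (a * a) (4 * e)))
    r = x ∸ a
    expand : ∀ a r → a * a + (2 * (a * r) + r * r) ≡ (a + r) * (a + r)
    expand = solve-∀
    gap : 2 * (a * r) + r * r ≡ 4 * e
    gap = +-cancelˡ-≡ (a * a) _ _ (trans (expand a r) (trans (cong (λ y → y * y) (m+[n∸m]≡n a≤x)) h))
    four : ∀ e → 4 * e ≡ 2 * e * 2
    four = solve-∀
    2∣sum : 2 ∣ 2 * (a * r) + r * r
    2∣sum = divides (2 * e) (trans gap (four e))
    four′ : ∀ a t → 4 * (t * (a + t)) ≡ 2 * (a * (t * 2)) + (t * 2) * (t * 2)
    four′ = solve-∀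
    halve : 2 ∣ r → ∃ λ t′ → x ≡ a + 2 * t′ × t′ * (a + t′) ≡ e
    halve (divides t′ r≡t′*2) = t′ ,
      trans (sym (m+[n∸m]≡n a≤x)) (cong (a +_) (trans r≡t′*2 (*-comm t′ 2))) ,
      *-cancelˡ-≡ _ _ 4 (trans (four′ a t′) (trans (cong (λ r → 2 * (a * r) + r * r) (sym r≡t′*2)) gap))

  -- (x, t) = ((p x′ + D t′)/2, (x′ + p t′)/2) is the step of the Lucas sequences, which negates x² - D t².
  norm-flip : ∀ {t t′ x x′} → x ≡ p * t + 2 * t′ → x′ + p * t′ ≡ 2 * t →
              x * x + x′ * x′ ≡ D * (t * t) + D * (t′ * t′)
  norm-flip {t} {t′} {x} {x′} refl h = *-cancelˡ-≡ _ _ 4 (begin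
    4 * ((p * t + 2 * t′) * (p * t + 2 * t′) + x′ * x′)
      ≡⟨ double-t p t t′ x′ ⟩
    (p * (2 * t) + 4 * t′) * (p * (2 * t) + 4 * t′) + 4 * (x′ * x′)
      ≡⟨ cong (λ s → (p * s + 4 * t′) * (p * s + 4 * t′) + 4 * (x′ * x′)) (sym h) ⟩
    (p * (x′ + p * t′) + 4 * t′) * (p * (x′ + p * t′) + 4 * t′) + 4 * (x′ * x′)
      ≡⟨ key p x′ t′ ⟩
    D * ((x′ + p * t′) * (x′ + p * t′)) + 4 * (D * (t′ * t′))
      ≡⟨ cong (λ s → D * (s * s) + 4 * (D * (t′ * t′))) h ⟩
    D * ((2 * t) * (2 * t)) + 4 * (D * (t′ * t′))
      ≡⟨ collect D t t′ ⟩
    4 * (D * (t * t) + D * (t′ * t′)) ∎)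
    where
    open ≡-Reasoning
    double-t : ∀ p t t′ x′ → 4 * ((p * t + 2 * t′) * (p * t + 2 * t′) + x′ * x′)
                           ≡ (p * (2 * t) + 4 * t′) * (p * (2 * t) + 4 * t′) + 4 * (x′ * x′)
    double-t = solve-∀
    key : ∀ p x t → (p * (x + p * t) + 4 * t) * (p * (x + p * t) + 4 * t) + 4 * (x * x)
                  ≡ (p * p + 4) * ((x + p * t) * (x + p * t)) + 4 * ((p * p + 4) * (t * t))
    key = solve-∀
    collect : ∀ D t t′ → D * ((2 * t) * (2 * t)) + 4 * (D * (t′ * t′)) ≡ 4 * (D * (t * t) + D * (t′ * t′))
    collect = solve-∀

  pt′≤2t : ∀ {t t′} → 1 ≤ t → t′ * (p * t + t′) ≤ t * t + 1 → p * t′ ≤ 2 * t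
  pt′≤2t {t} {t′} t≥1 h = ≮⇒≥ λ 2t<pt′ → <⇒≱ (too-big 2t<pt′) h
    where
    open ≤-Reasoning
    too-big : 2 * t < p * t′ → t * t + 1 < t′ * (p * t + t′)
    too-big 2t<pt′ = begin-strict
      t * t + 1          <⟨ +-monoʳ-< (t * t) (+-mono-≤ (*-mono-≤ t≥1 t≥1) t≥1) ⟩
      t * t + (t * t + t) ≡⟨ expand t ⟩
      t * suc (2 * t)    ≤⟨ *-monoʳ-≤ t 2t<pt′ ⟩
      t * (p * t′)       ≡⟨ rearrange p t t′ ⟩
      p * t * t′         ≤⟨ m≤m+n (p * t * t′) (t′ * t′) ⟩
      p * t * t′ + t′ * t′ ≡⟨ factor p t t′ ⟩
      t′ * (p * t + t′)  ∎
      where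
      expand : ∀ t → t * t + (t * t + t) ≡ t * suc (2 * t)
      expand = solve-∀
      rearrange : ∀ p t t′ → t * (p * t′) ≡ p * t * t′
      rearrange = solve-∀
      factor : ∀ p t t′ → p * t * t′ + t′ * t′ ≡ t′ * (p * t + t′)
      factor = solve-∀

  record Predecessor (t x e : ℕ) : Set where
    field
      t′ x′  : ℕ
      x≡     : x ≡ p * t + 2 * t′
      2t≡    : x′ + p * t′ ≡ 2 * t
      t′-eq  : t′ * (p * t + t′) ≡ e

  predecessor : ∀ {t x e} → 1 ≤ t → x * x ≡ (p * t) * (p * t) + 4 * e → e ≤ t * t + 1 → Predecessor t x e
  predecessor {t} {x} {e} t≥1 h e≤ = record
    { t′ = t′ ; x′ = 2 * t ∸ p * t′ ; x≡ = proj₁ (proj₂ half)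
    ; 2t≡ = m∸n+n≡m (pt′≤2t t≥1 (subst (_≤ t * t + 1) (sym t′-eq) e≤)) ; t′-eq = t′-eq }
    where
    half = halve-gap x t e h
    t′ = proj₁ half
    t′-eq : t′ * (p * t + t′) ≡ e
    t′-eq = proj₂ (proj₂ half)

  predecessor-lucas : ∀ {t x e k} (P : Predecessor t x e) → Predecessor.x′ P ≡ v k → Predecessor.t′ P ≡ u k →
                      x ≡ v (suc k) × t ≡ u (suc k)
  predecessor-lucas {t} {x} {e} {k} P x′≡ t′≡ = x≡v , t≡u
    where
    open Predecessor P
    t≡u : t ≡ u (suc k)
    t≡u = *-cancelˡ-≡ t (u (suc k)) 2 (begin
      2 * t            ≡⟨ 2t≡ ⟨
      x′ + p * t′      ≡⟨ cong₂ (λ a b → a + p * b) x′≡ t′≡ ⟩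
      v k + p * u k    ≡⟨ double-u-suc k ⟨
      2 * u (suc k)    ∎)
      where open ≡-Reasoning
    x≡v : x ≡ v (suc k)
    x≡v = *-cancelˡ-≡ x (v (suc k)) 2 (begin
      2 * x                          ≡⟨ cong (2 *_) x≡ ⟩
      2 * (p * t + 2 * t′)           ≡⟨ expand p t t′ ⟩
      p * (2 * t) + 4 * t′           ≡⟨ cong (λ s → p * s + 4 * t′) 2t≡ ⟨
      p * (x′ + p * t′) + 4 * t′     ≡⟨ cong₂ (λ a b → p * (a + p * b) + 4 * b) x′≡ t′≡ ⟩
      p * (v k + p * u k) + 4 * u k  ≡⟨ collect p (v k) (u k) ⟩
      p * v k + D * u k              ≡⟨ double-v-suc k ⟨
      2 * v (suc k)                  ∎)
      where
      open ≡-Reasoning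
      expand : ∀ p t u → 2 * (p * t + 2 * u) ≡ p * (2 * t) + 4 * u
      expand = solve-∀
      collect : ∀ p v u → p * (v + p * u) + 4 * u ≡ p * v + (p * p + 4) * u
      collect = solve-∀

  EvenSolutions OddSolutions : ℕ → Set
  EvenSolutions t = ∀ x → x * x ≡ D * (t * t) + 4 → ∃ λ j → x ≡ v (2 * j) × t ≡ u (2 * j)
  OddSolutions t = ∀ x → x * x + 4 ≡ D * (t * t) → ∃ λ j → x ≡ v (suc (2 * j)) × t ≡ u (suc (2 * j))

  -- Descent on t: the predecessor of a solution of either equation solves the other one
  -- with a smaller t, except that a solution of x² = D t² + 4 may keep its t; so at each t
  -- the odd case is settled first.
  pell-solutions : ∀ t → EvenSolutions t × OddSolutions t
  pell-solutions = <-rec _ step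
    where
    split : ∀ p t → (p * p + 4) * (t * t) ≡ (p * t) * (p * t) + 4 * (t * t)
    split = solve-∀

    step : ∀ t → (∀ {s} → s < t → EvenSolutions s × OddSolutions s) → EvenSolutions t × OddSolutions t
    step zero _ = even₀ , odd₀
      where
      even₀ : EvenSolutions 0
      even₀ x h = 0 , ≤-antisym (m*m≤n*n⇒m≤n (≤-reflexive h₄)) (m*m≤n*n⇒m≤n (≤-reflexive (sym h₄))) , refl
        where
        h₄ : x * x ≡ 2 * 2
        h₄ = trans h (cong (_+ 4) (*-zeroʳ D))
      odd₀ : OddSolutions 0
      odd₀ x h = ⊥-elim (1+n≢0 (trans (+-comm 1 (x * x + 3)) (trans (+-assoc (x * x) 3 1) (trans h (*-zeroʳ D)))))
    step t@(suc t₀) ih = even , odd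
      where
      e : ℕ
      e = t₀ + t₀ * t
      t≥1 : 1 ≤ t
      t≥1 = s≤s z≤n

      odd : OddSolutions t
      odd x h = j , x≡v , t≡u
        where
        rearrange : ∀ A e → A + 4 * suc e ≡ A + 4 * e + 4
        rearrange = solve-∀
        P = predecessor t≥1 (+-cancelʳ-≡ 4 _ _ (trans h (trans (split p t) (rearrange ((p * t) * (p * t)) e))))
                        (≤-trans (n≤1+n e) (m≤m+n (t * t) 1))
        open Predecessor P
        t′<t : t′ < t
        t′<t = ≰⇒> λ t≤t′ → <-irrefl refl (begin-strict
          t * t                ≤⟨ *-mono-≤ t≤t′ t≤t′ ⟩
          t′ * t′              ≤⟨ *-monoʳ-≤ t′ (m≤n+m t′ (p * t)) ⟩
          t′ * (p * t + t′)    ≡⟨ t′-eq ⟩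
          e                    <⟨ n<1+n e ⟩
          t * t                ∎)
          where open ≤-Reasoning
        x′-even : x′ * x′ ≡ D * (t′ * t′) + 4
        x′-even = +-cancelˡ-≡ (x * x + 4) _ _ (begin
          x * x + 4 + x′ * x′        ≡⟨ swap (x * x) 4 (x′ * x′) ⟩
          x * x + x′ * x′ + 4        ≡⟨ cong (_+ 4) (norm-flip x≡ 2t≡) ⟩
          D * (t * t) + D * (t′ * t′) + 4 ≡⟨ +-assoc (D * (t * t)) (D * (t′ * t′)) 4 ⟩
          D * (t * t) + (D * (t′ * t′) + 4) ≡⟨ cong (_+ (D * (t′ * t′) + 4)) h ⟨
          x * x + 4 + (D * (t′ * t′) + 4) ∎)
          where
          open ≡-Reasoning
          swap : ∀ a b c → a + b + c ≡ a + c + b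
          swap = solve-∀
        previous = proj₁ (ih t′<t) x′ x′-even
        j = proj₁ previous
        lifted = predecessor-lucas {k = 2 * j} P (proj₁ (proj₂ previous)) (proj₂ (proj₂ previous))
        x≡v = proj₁ lifted
        t≡u = proj₂ lifted

      odd-below : ∀ {s} → s ≤ t → OddSolutions s
      odd-below s≤t with m≤n⇒m<n∨m≡n s≤t
      ... | inj₁ s<t = proj₂ (ih s<t)
      ... | inj₂ refl = odd

      even : EvenSolutions t
      even x h = suc j , subst (λ i → x ≡ v i) (sym (*-suc 2 j)) x≡v , subst (λ i → t ≡ u i) (sym (*-suc 2 j)) t≡u
        where
        rearrange : ∀ A T → A + 4 * T + 4 ≡ A + 4 * (T + 1)
        rearrange = solve-∀
        P = predecessor t≥1 (trans h (trans (cong (_+ 4) (split p t)) (rearrange ((p * t) * (p * t)) (t * t)))) ≤-refl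
        open Predecessor P
        t′≤t : t′ ≤ t
        t′≤t = ≮⇒≥ λ t<t′ → <⇒≱ (subst (t * t + 1 <_) (expand t) (m<m+n (t * t + 1) (s≤s z≤n))) (begin
          suc t * suc t        ≤⟨ *-mono-≤ t<t′ t<t′ ⟩
          t′ * t′              ≤⟨ *-monoʳ-≤ t′ (m≤n+m t′ (p * t)) ⟩
          t′ * (p * t + t′)    ≡⟨ t′-eq ⟩
          t * t + 1            ∎)
          where
          open ≤-Reasoning
          expand : ∀ t → t * t + 1 + 2 * t ≡ suc t * suc t
          expand = solve-∀
        x′-odd : x′ * x′ + 4 ≡ D * (t′ * t′)
        x′-odd = +-cancelˡ-≡ (D * (t * t)) _ _ (begin
          D * (t * t) + (x′ * x′ + 4)   ≡⟨ swap (D * (t * t)) (x′ * x′) 4 ⟩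
          D * (t * t) + 4 + x′ * x′     ≡⟨ cong (_+ x′ * x′) h ⟨
          x * x + x′ * x′               ≡⟨ norm-flip x≡ 2t≡ ⟩
          D * (t * t) + D * (t′ * t′)   ∎)
          where
          open ≡-Reasoning
          swap : ∀ a b c → a + (b + c) ≡ a + c + b
          swap = solve-∀
        previous = odd-below t′≤t x′ x′-odd
        j = proj₁ previous
        lifted = predecessor-lucas {k = suc (2 * j)} P (proj₁ (proj₂ previous)) (proj₂ (proj₂ previous))
        x≡v = proj₁ lifted
        t≡u = proj₂ lifted

coprime-decomposition : ∀ a b → 1 ≤ a →
  ∃ λ g → ∃ λ a′ → ∃ λ b′ → a ≡ a′ * g × b ≡ b′ * g × 1 ≤ g × Coprime a′ b′
coprime-decomposition a b a≥1 = g , quotient g∣a , quotient g∣b ,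
  m∣n⇒n≡quotient*m g∣a , m∣n⇒n≡quotient*m g∣b , g≥1 , coprime
  where
  g = gcd a b
  g∣a = gcd[m,n]∣m a b
  g∣b = gcd[m,n]∣n a b
  g≥1 : 1 ≤ g
  g≥1 = n≢0⇒n>0 (gcd[m,n]≢0 a b (inj₁ λ a≡0 → <⇒≢ a≥1 (sym a≡0)))
  instance
    g≢0 : NonZero g
    g≢0 = ℕ.>-nonZero g≥1
  coprime : Coprime (quotient g∣a) (quotient g∣b)
  coprime {d} (d∣a′ , d∣b′) = ∣1⇒≡1 (*-cancelʳ-∣ g (subst (d * g ∣_) (sym (*-identityˡ g))
    (gcd-greatest (subst (d * g ∣_) (sym (m∣n⇒n≡quotient*m g∣a)) (*-monoˡ-∣ g d∣a′))
                  (subst (d * g ∣_) (sym (m∣n⇒n≡quotient*m g∣b)) (*-monoˡ-∣ g d∣b′)))))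

m*m∣n*n⇒m∣n : ∀ m n → 1 ≤ m → m * m ∣ n * n → m ∣ n
m*m∣n*n⇒m∣n m n m≥1 h with coprime-decomposition m n m≥1
... | g , m′ , n′ , refl , refl , g≥1 , coprime = subst (_∣ n′ * g) (sym m≡g) (n∣m*n n′)
  where
  instance
    g*g≢0 : NonZero (g * g)
    g*g≢0 = ℕ.>-nonZero (*-mono-≤ g≥1 g≥1)
  regroup : ∀ x g → x * g * (x * g) ≡ x * x * (g * g)
  regroup = solve-∀
  m′≡1 : m′ ≡ 1
  m′≡1 = coprime (∣-refl , coprime-divisor coprime
           (m*n∣⇒m∣ m′ m′ (*-cancelʳ-∣ (g * g) (subst₂ _∣_ (regroup m′ g) (regroup n′ g) h))))
  m≡g : m′ * g ≡ g
  m≡g = trans (cong (_* g) m′≡1) (*-identityˡ g)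

squareFree⇒≥1 : ∀ {D} → SquareFree (ℤ.+ D) → 1 ≤ D
squareFree⇒≥1 {zero} sf with sf 2 (divides 0 refl)
... | ()
squareFree⇒≥1 {suc D} sf = s≤s z≤n

squareFree∧∣sq⇒∣ : ∀ D s → SquareFree (ℤ.+ D) → D ∣ s * s → D ∣ s
squareFree∧∣sq⇒∣ D s sf h with coprime-decomposition D s (squareFree⇒≥1 sf)
... | g , d′ , s′ , refl , refl , g≥1 , coprime = subst (_∣ s′ * g) (sym d≡g) (n∣m*n s′)
  where
  instance
    g≢0 : NonZero g
    g≢0 = ℕ.>-nonZero g≥1
  regroup : ∀ s g → s * g * (s * g) ≡ s * (s * g) * g
  regroup = solve-∀
  d′∣g : d′ ∣ g
  d′∣g = coprime-divisor coprime (coprime-divisor coprime (*-cancelʳ-∣ g (subst (d′ * g ∣_) (regroup s′ g) h)))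
  d′≡1 : d′ ≡ 1
  d′≡1 = sf d′ (*-monoʳ-∣ d′ d′∣g)
  d≡g : d′ * g ≡ g
  d≡g = trans (cong (_* g) d′≡1) (*-identityˡ g)

sq-factor-cancel : ∀ a U c z → 1 ≤ U → a * (U * U) * c ≡ z * z → ∃ λ s → a * c ≡ s * s
sq-factor-cancel a U c z U≥1 e = cancel (m*m∣n*n⇒m∣n U z U≥1 (divides (a * c) (trans (sym e) (regroup a U c))))
  where
  regroup : ∀ a U c → a * (U * U) * c ≡ a * c * (U * U)
  regroup = solve-∀
  regroup′ : ∀ s U → s * U * (s * U) ≡ s * s * (U * U)
  regroup′ = solve-∀
  instance
    U*U≢0 : NonZero (U * U)
    U*U≢0 = ℕ.>-nonZero (*-mono-≤ U≥1 U≥1)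
  cancel : U ∣ z → ∃ λ s → a * c ≡ s * s
  cancel (divides s refl) = s , *-cancelʳ-≡ _ _ (U * U) (trans (sym (regroup a U c)) (trans e (regroup′ s U)))

squareFree-square : ∀ {D c s} → SquareFree (ℤ.+ D) → D * c ≡ s * s → ∃ λ t → c ≡ D * (t * t)
squareFree-square {D} {c} {s} sf e = extract (squareFree∧∣sq⇒∣ D s sf (divides c (trans (sym e) (*-comm D c))))
  where
  regroup : ∀ t D → t * D * (t * D) ≡ D * (D * (t * t))
  regroup = solve-∀
  extract : D ∣ s → ∃ λ t → c ≡ D * (t * t)
  extract (divides t refl) = t , *-cancelˡ-≡ c (D * (t * t)) D {{ℕ.>-nonZero (squareFree⇒≥1 sf)}}
                                   (trans e (regroup t D))

module LucasMarkov (p : ℕ) (p≥1 : 1 ≤ p) (sf : SquareFree (ℤ.+ Lucas.D p)) where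
  open Lucas p
  open Growth p≥1

  -- w² - 4 = D T² with T ≥ 1, so the discriminant (x² - 4) D T² is a square and, D being
  -- square-free, x² - 4 = D s².
  markov⇒lucas : ∀ m {x y} → 2 ≤ x → Markov x y (v (2 * suc m)) → ∃ λ a → x ≡ v (2 * a)
  markov⇒lucas m {x} {y} x≥2 hM = lucas x-pell
    where
    T = u (2 * suc m)
    T≥1 : 1 ≤ T
    T≥1 = n≢0⇒n>0 λ T≡0 → <⇒≱ (v-even-suc≥3 m) (m*m≤n*n⇒m≤n (≤-reflexive
            (trans (pell-v-even (suc m)) (trans (cong (λ q → D * (q * q) + 4) T≡0) (cong (_+ 4) (*-zeroʳ D))))))
    c = x * x ∸ 4
    x²≡c+4 : x * x ≡ c + 4
    x²≡c+4 = sym (m∸n+n≡m (*-mono-≤ x≥2 x≥2))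
    disc : ∃ λ z → D * (T * T) * c ≡ z * z
    disc = markov-discriminant hM x²≡c+4 (pell-v-even (suc m))
    Dc-square : ∃ λ r → D * c ≡ r * r
    Dc-square = sq-factor-cancel D T c (proj₁ disc) T≥1 (proj₂ disc)
    c-form : ∃ λ s → c ≡ D * (s * s)
    c-form = squareFree-square {s = proj₁ Dc-square} sf (proj₂ Dc-square)
    x-pell : ∃ λ s → x * x ≡ D * (s * s) + 4
    x-pell = proj₁ c-form , trans x²≡c+4 (cong (_+ 4) (proj₂ c-form))
    lucas : (∃ λ s → x * x ≡ D * (s * s) + 4) → ∃ λ a → x ≡ v (2 * a)
    lucas (s , e) with proj₁ (Pell.pell-solutions p s) x e
    ... | j , x≡v , _ = j , x≡v

  markov-v-even-∣-∣ : ∀ a m → Markov (v (2 * a)) (v (2 * ∣ a - m ∣)) (v (2 * m))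
  markov-v-even-∣-∣ a m with ≤-total a m
  ... | inj₁ a≤m = subst₂ (λ i j → Markov (v (2 * a)) (v (2 * i)) (v j)) (sym (m≤n⇒∣m-n∣≡n∸m a≤m))
                     (trans (sym (*-distribˡ-+ 2 a (m ∸ a))) (cong (2 *_) (m+[n∸m]≡n a≤m))) (markov-v-even a (m ∸ a))
  ... | inj₂ m≤a = markov-swap₁₂ (markov-swap₂₃ (subst₂ (λ i j → Markov (v (2 * i)) (v (2 * m)) (v j))
                     (sym (m≤n⇒∣n-m∣≡n∸m m≤a))
                     (trans (sym (*-distribˡ-+ 2 (a ∸ m) m)) (cong (2 *_) (m∸n+n≡m m≤a))) (markov-v-even (a ∸ m) m)))

  markov-v-even-roots : ∀ m a {y} → 1 ≤ m → Markov (v (2 * a)) y (v (2 * m)) →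
                        y ≡ v (2 * a + 2 * m) ⊎ y ≡ v (2 * ∣ a - m ∣)
  markov-v-even-roots m zero _ hM = inj₁ (markov-2⇒≡ hM)
  markov-v-even-roots m a@(suc _) {y} m≥1 hM = markov-two-roots hM
    (markov-swap₂₃ (markov-v-even a m)) (markov-v-even-∣-∣ a m)
    (λ e → <⇒≢ (v-even-strictMono (∣m-n∣<m+n (s≤s z≤n) m≥1)) (sym (trans (cong v (*-distribˡ-+ 2 a m)) e)))

  lucasProduct-of-root : ∀ m a {y} → Prime (v (2 * a)) → Prime y → v (2 * a) < y →
                         y ≡ v (2 * a + 2 * m) ⊎ y ≡ v (2 * ∣ a - m ∣) → LucasProduct m (v (2 * a) * y)
  lucasProduct-of-root m a px py x<y (inj₁ refl) = inj₁ (a , refl , px , py)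
  lucasProduct-of-root m a px py x<y (inj₂ refl) with ≤-total a m
  ... | inj₁ a≤m = inj₂ (a , *-monoʳ-≤ 2 a≤m , m≢2a , cong (v (2 * a) *_) y≡ , px , subst Prime y≡ py)
    where
    y≡ : v (2 * ∣ a - m ∣) ≡ v (2 * m ∸ 2 * a)
    y≡ = cong v (trans (cong (2 *_) (m≤n⇒∣m-n∣≡n∸m a≤m)) (*-distribˡ-∸ 2 m a))
    m≢2a : m ≢ 2 * a
    m≢2a m≡2a = <-irrefl (cong (λ i → v (2 * i)) (sym ∣a-m∣≡a)) x<y
      where
      ∣a-m∣≡a : ∣ a - m ∣ ≡ a
      ∣a-m∣≡a = trans (m≤n⇒∣m-n∣≡n∸m a≤m)
                  (trans (cong (_∸ a) (trans m≡2a (cong (a +_) (+-identityʳ a)))) (m+n∸m≡n a a))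
  ... | inj₂ m≤a = inj₁ (a ∸ m , trans (*-comm (v (2 * a)) _) (cong₂ _*_ y≡ x≡) , subst Prime y≡ py , subst Prime x≡ px)
    where
    y≡ : v (2 * ∣ a - m ∣) ≡ v (2 * (a ∸ m))
    y≡ = cong (λ i → v (2 * i)) (m≤n⇒∣n-m∣≡n∸m m≤a)
    x≡ : v (2 * a) ≡ v (2 * (a ∸ m) + 2 * m)
    x≡ = cong v (trans (cong (2 *_) (sym (m∸n+n≡m m≤a))) (*-distribˡ-+ 2 (a ∸ m) m))

  markov-primes⇒lucasProduct : ∀ m {x y} → Prime x → Prime y → x < y → Markov x y (v (2 * m)) →
                               LucasProduct m (x * y)
  markov-primes⇒lucasProduct zero px py x<y hM = ⊥-elim (<⇒≢ x<y (markov-2⇒≡ (markov-swap₁₂ (markov-swap₂₃ hM))))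
  markov-primes⇒lucasProduct (suc m) {x} {y} px py x<y hM = from-index (markov⇒lucas m (prime⇒≥2 px) hM)
    where
    from-index : (∃ λ a → x ≡ v (2 * a)) → LucasProduct (suc m) (x * y)
    from-index (a , x≡) = subst (λ x → LucasProduct (suc m) (x * y)) (sym x≡)
      (lucasProduct-of-root (suc m) a (subst Prime x≡ px) py (subst (_< y) x≡ x<y)
        (markov-v-even-roots (suc m) a (s≤s z≤n) (subst (λ x → Markov x y (v (2 * suc m))) x≡ hM)))

-- Sums of squares of divisors

sumTo : ℕ → (ℕ → ℕ) → ℕ
sumTo n f = sum (map f (map suc (upTo n)))

sumTo-suc : ∀ n f → sumTo (suc n) f ≡ sumTo n f + f (suc n)
sumTo-suc n f = begin
  sum (map f (map suc (upTo (suc n))))            ≡⟨ cong (sum ∘ map f ∘ map suc) (upTo-∷ʳ n) ⟨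
  sum (map f (map suc (upTo n ++ [ n ])))         ≡⟨ cong (sum ∘ map f) (map-++ suc (upTo n) [ n ]) ⟩
  sum (map f (map suc (upTo n) ++ [ suc n ]))     ≡⟨ cong sum (map-++ f (map suc (upTo n)) [ suc n ]) ⟩
  sum (map f (map suc (upTo n)) ++ [ f (suc n) ]) ≡⟨ sum-++ (map f (map suc (upTo n))) [ f (suc n) ] ⟩
  sumTo n f + (f (suc n) + 0)                     ≡⟨ cong (sumTo n f +_) (+-identityʳ (f (suc n))) ⟩
  sumTo n f + f (suc n)                           ∎
  where open ≡-Reasoning

sumTo-mono : ∀ n {f g} → (∀ {d} → 1 ≤ d → d ≤ n → f d ≤ g d) → sumTo n f ≤ sumTo n g
sumTo-mono zero le = z≤n
sumTo-mono (suc n) {f} {g} le = subst₂ _≤_ (sym (sumTo-suc n f)) (sym (sumTo-suc n g))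
  (+-mono-≤ (sumTo-mono n λ d≥1 d≤n → le d≥1 (m≤n⇒m≤1+n d≤n)) (le (s≤s z≤n) ≤-refl))

sumTo-cong : ∀ n {f g} → (∀ {d} → 1 ≤ d → d ≤ n → f d ≡ g d) → sumTo n f ≡ sumTo n g
sumTo-cong n eq = ≤-antisym (sumTo-mono n λ d≥1 d≤n → ≤-reflexive (eq d≥1 d≤n))
                            (sumTo-mono n λ d≥1 d≤n → ≤-reflexive (sym (eq d≥1 d≤n)))

sumTo-+ : ∀ n f g → sumTo n (λ d → f d + g d) ≡ sumTo n f + sumTo n g
sumTo-+ zero f g = refl
sumTo-+ (suc n) f g = begin
  sumTo (suc n) (λ d → f d + g d)                       ≡⟨ sumTo-suc n _ ⟩
  sumTo n (λ d → f d + g d) + (f (suc n) + g (suc n))   ≡⟨ cong (_+ (f (suc n) + g (suc n))) (sumTo-+ n f g) ⟩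
  sumTo n f + sumTo n g + (f (suc n) + g (suc n))       ≡⟨ shuffle (sumTo n f) (sumTo n g) (f (suc n)) (g (suc n)) ⟩
  (sumTo n f + f (suc n)) + (sumTo n g + g (suc n))     ≡⟨ cong₂ _+_ (sumTo-suc n f) (sumTo-suc n g) ⟨
  sumTo (suc n) f + sumTo (suc n) g                     ∎
  where
  open ≡-Reasoning
  shuffle : ∀ a b c d → a + b + (c + d) ≡ a + c + (b + d)
  shuffle = solve-∀

sumTo-zero : ∀ n → sumTo n (λ _ → 0) ≡ 0
sumTo-zero zero = refl
sumTo-zero (suc n) = trans (sumTo-suc n _) (trans (+-identityʳ _) (sumTo-zero n))

point : ℕ → ℕ → ℕ → ℕ
point a c d with a ≟ d
... | yes _ = c
... | no _ = 0

point-≡ : ∀ a c → point a c a ≡ c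
point-≡ a c with a ≟ a
... | yes _ = refl
... | no a≢a = ⊥-elim (a≢a refl)

point-≢ : ∀ {a d} c → a ≢ d → point a c d ≡ 0
point-≢ {a} {d} c a≢d with a ≟ d
... | yes a≡d = ⊥-elim (a≢d a≡d)
... | no _ = refl

sumTo-point : ∀ n {a} c → 1 ≤ a → a ≤ n → sumTo n (point a c) ≡ c
sumTo-point zero c a≥1 a≤0 = ⊥-elim (<⇒≱ a≥1 a≤0)
sumTo-point (suc n) {a} c a≥1 a≤1+n = trans (sumTo-suc n _) (at-end (m≤n⇒m<n∨m≡n a≤1+n))
  where
  at-end : a < suc n ⊎ a ≡ suc n → sumTo n (point a c) + point a c (suc n) ≡ c
  at-end (inj₁ (s≤s a≤n)) = trans (cong₂ _+_ (sumTo-point n c a≥1 a≤n) (point-≢ c (<⇒≢ (s≤s a≤n)))) (+-identityʳ c)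
  at-end (inj₂ refl) = cong₂ _+_ (trans (sumTo-cong n λ _ d≤n → point-≢ c (>⇒≢ (s≤s d≤n))) (sumTo-zero n))
                                  (point-≡ (suc n) c)

divisorSquare : ℕ → ℕ → ℕ
divisorSquare n d with d ∣? n
... | yes _ = d * d
... | no _ = 0

σ₂≡sumTo : ∀ n → σ₂ n ≡ sumTo n (divisorSquare n)
σ₂≡sumTo n = sum-filter (map suc (upTo n))
  where
  sum-filter : ∀ ds → sum (map (λ d → d * d) (filter (_∣? n) ds)) ≡ sum (map (divisorSquare n) ds)
  sum-filter [] = refl
  sum-filter (d ∷ ds) with d ∣? n
  ... | yes _ = cong (d * d +_) (sum-filter ds)
  ... | no _ = sum-filter ds

sumOfSquares : List ℕ → ℕ
sumOfSquares ds = sum (map (λ d → d * d) ds)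

squarePoints : List ℕ → ℕ → ℕ
squarePoints [] d = 0
squarePoints (a ∷ as) d = point a (a * a) d + squarePoints as d

squarePoints-∈ : ∀ {d as} → d ∈ as → d * d ≤ squarePoints as d
squarePoints-∈ {d} (here refl) = ≤-trans (≤-reflexive (sym (point-≡ d (d * d)))) (m≤m+n _ _)
squarePoints-∈ {d} {a ∷ _} (there d∈as) = ≤-trans (squarePoints-∈ d∈as) (m≤n+m _ (point a (a * a) d))

squarePoints-∉ : ∀ {d} as → d ∉ as → squarePoints as d ≡ 0
squarePoints-∉ [] _ = refl
squarePoints-∉ (a ∷ as) d∉ = cong₂ _+_ (point-≢ (a * a) λ a≡d → d∉ (here (sym a≡d))) (squarePoints-∉ as (d∉ ∘ there))

squarePoints-unique : ∀ {d as} → Unique as → d ∈ as → squarePoints as d ≡ d * d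
squarePoints-unique {d} {_ ∷ as} (d∉ ∷ _) (here refl) =
  trans (cong₂ _+_ (point-≡ d (d * d)) (squarePoints-∉ as λ d∈as → All.lookup d∉ d∈as refl)) (+-identityʳ _)
squarePoints-unique {d} {a ∷ as} (a∉ ∷ unique) (there d∈as) =
  cong₂ _+_ (point-≢ (a * a) (All.lookup a∉ d∈as)) (squarePoints-unique unique d∈as)

divisorSquare-∣ : ∀ {n d} → d ∣ n → divisorSquare n d ≡ d * d
divisorSquare-∣ {n} {d} d∣n with d ∣? n
... | yes _ = refl
... | no d∤n = ⊥-elim (d∤n d∣n)

divisor≥1 : ∀ {n d} → 1 ≤ n → d ∣ n → 1 ≤ d
divisor≥1 {n} {zero} n≥1 0∣n = ⊥-elim (<⇒≢ n≥1 (sym (0∣⇒≡0 0∣n)))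
divisor≥1 {n} {suc d} _ _ = s≤s z≤n

sumTo-squarePoints : ∀ {n} ds → 1 ≤ n → All (_∣ n) ds → sumTo n (squarePoints ds) ≡ sumOfSquares ds
sumTo-squarePoints {n} [] _ _ = sumTo-zero n
sumTo-squarePoints {n} (d ∷ ds) n≥1 (d∣n ∷ ds∣n) =
  trans (sumTo-+ n (point d (d * d)) (squarePoints ds))
        (cong₂ _+_ (sumTo-point n (d * d) (divisor≥1 n≥1 d∣n) (∣⇒≤ {{ℕ.>-nonZero n≥1}} d∣n))
                   (sumTo-squarePoints ds n≥1 ds∣n))

increasing⇒unique : ∀ {ds} → Linked _<_ ds → Unique ds
increasing⇒unique = AllPairs.map <⇒≢ ∘ Linked⇒AllPairs <-trans

sumOfSquares≤σ₂ : ∀ {n ds} → 1 ≤ n → Linked _<_ ds → All (_∣ n) ds → sumOfSquares ds ≤ σ₂ n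
sumOfSquares≤σ₂ {n} {ds} n≥1 increasing ds∣n =
  subst₂ _≤_ (sumTo-squarePoints ds n≥1 ds∣n) (sym (σ₂≡sumTo n)) (sumTo-mono n pointwise)
  where
  pointwise : ∀ {d} → 1 ≤ d → d ≤ n → squarePoints ds d ≤ divisorSquare n d
  pointwise {d} _ _ with d ∈? ds
  ... | yes d∈ds = ≤-reflexive (trans (squarePoints-unique (increasing⇒unique increasing) d∈ds)
                                      (sym (divisorSquare-∣ (All.lookup ds∣n d∈ds))))
  ... | no d∉ds = subst (_≤ divisorSquare n d) (sym (squarePoints-∉ ds d∉ds)) z≤n

σ₂≡sumOfSquares : ∀ {n ds} → 1 ≤ n → Linked _<_ ds → All (_∣ n) ds → (∀ {d} → d ∣ n → d ∈ ds) →
                  σ₂ n ≡ sumOfSquares ds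
σ₂≡sumOfSquares {n} {ds} n≥1 increasing ds∣n complete = ≤-antisym
  (subst₂ _≤_ (sym (σ₂≡sumTo n)) (sumTo-squarePoints ds n≥1 ds∣n) (sumTo-mono n pointwise))
  (sumOfSquares≤σ₂ n≥1 increasing ds∣n)
  where
  pointwise : ∀ {d} → 1 ≤ d → d ≤ n → divisorSquare n d ≤ squarePoints ds d
  pointwise {d} _ _ with d ∣? n
  ... | yes d∣n = squarePoints-∈ (complete d∣n)
  ... | no _ = z≤n

∣p*n⇒ : ∀ {p n d} → Prime p → d ∣ p * n → (∃ λ e → d ≡ p * e × e ∣ n) ⊎ d ∣ n
∣p*n⇒ {p} {n} {d} pp (divides q pn≡qd) with euclidsLemma q d pp (divides n (trans (sym pn≡qd) (*-comm p n)))
... | inj₂ (divides e refl) = inj₁ (e , *-comm e p , divides q (*-cancelˡ-≡ n (q * e) p {{prime⇒nonZero pp}}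
                                (trans pn≡qd (regroup q e p))))
  where
  regroup : ∀ q e p → q * (e * p) ≡ p * (q * e)
  regroup = solve-∀
... | inj₁ (divides f refl) = inj₂ (divides f (*-cancelˡ-≡ n (f * d) p {{prime⇒nonZero pp}}
                                (trans pn≡qd (regroup f p d))))
  where
  regroup : ∀ f p d → f * p * d ≡ p * (f * d)
  regroup = solve-∀

σ₂-prime : ∀ {p} → Prime p → σ₂ p ≡ 1 + p * p
σ₂-prime {p} pp = trans (σ₂≡sumOfSquares (<⇒≤ 1<p) (1<p ∷ [-]) (1∣ p ∷ ∣-refl ∷ []) complete) (tidy p)
  where
  1<p = prime⇒≥2 pp
  complete : ∀ {d} → d ∣ p → d ∈ 1 ∷ p ∷ []
  complete d∣p with prime⇒irreducible pp d∣p
  ... | inj₁ d≡1 = here d≡1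
  ... | inj₂ d≡p = there (here d≡p)
  tidy : ∀ p → 1 * 1 + (p * p + 0) ≡ 1 + p * p
  tidy = solve-∀

σ₂-prime² : ∀ {p} → Prime p → σ₂ (p * p) ≡ 1 + p * p + (p * p) * (p * p)
σ₂-prime² {p} pp = trans (σ₂≡sumOfSquares (<⇒≤ (<-trans 1<p p<p²)) (1<p ∷ p<p² ∷ [-])
                           (1∣ (p * p) ∷ m∣m*n p ∷ ∣-refl ∷ []) complete) (tidy p)
  where
  1<p = prime⇒≥2 pp
  p<p² : p < p * p
  p<p² = m<m*n p p {{prime⇒nonZero pp}} 1<p
  complete : ∀ {d} → d ∣ p * p → d ∈ 1 ∷ p ∷ p * p ∷ []
  complete d∣p² with ∣p*n⇒ pp d∣p²
  ... | inj₂ d∣p = [ here , there ∘ here ]′ (prime⇒irreducible pp d∣p)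
  ... | inj₁ (e , refl , e∣p) = [ (λ e≡1 → there (here (trans (cong (p *_) e≡1) (*-identityʳ p)))) ,
                                   (λ e≡p → there (there (here (cong (p *_) e≡p)))) ]′ (prime⇒irreducible pp e∣p)
  tidy : ∀ p → 1 * 1 + (p * p + ((p * p) * (p * p) + 0)) ≡ 1 + p * p + (p * p) * (p * p)
  tidy = solve-∀

σ₂-semiprime : ∀ {p q} → Prime p → Prime q → p < q → σ₂ (p * q) ≡ 1 + p * p + q * q + (p * q) * (p * q)
σ₂-semiprime {p} {q} pp pq p<q = trans (σ₂≡sumOfSquares (<⇒≤ (<-trans (<-trans 1<p p<q) q<pq)) (1<p ∷ p<q ∷ q<pq ∷ [-])
                                   (1∣ (p * q) ∷ m∣m*n q ∷ n∣m*n p ∷ ∣-refl ∷ []) complete) (tidy p q)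
  where
  1<p = prime⇒≥2 pp
  q<pq : q < p * q
  q<pq = subst (q <_) (*-comm q p) (m<m*n q p {{prime⇒nonZero pq}} 1<p)
  complete : ∀ {d} → d ∣ p * q → d ∈ 1 ∷ p ∷ q ∷ p * q ∷ []
  complete d∣pq with ∣p*n⇒ pp d∣pq
  ... | inj₂ d∣q = [ here , there ∘ there ∘ here ]′ (prime⇒irreducible pq d∣q)
  ... | inj₁ (e , refl , e∣q) = [ (λ e≡1 → there (here (trans (cong (p *_) e≡1) (*-identityʳ p)))) ,
                                   (λ e≡q → there (there (there (here (cong (p *_) e≡q))))) ]′ (prime⇒irreducible pq e∣q)
  tidy : ∀ p q → 1 * 1 + (p * p + (q * q + ((p * q) * (p * q) + 0))) ≡ 1 + p * p + q * q + (p * q) * (p * q)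
  tidy = solve-∀

σ₂-≥-four : ∀ {n a b} → 1 < a → a < b → b < n → a ∣ n → b ∣ n → 1 + a * a + b * b + n * n ≤ σ₂ n
σ₂-≥-four {n} {a} {b} 1<a a<b b<n a∣n b∣n = subst (_≤ σ₂ n) (tidy n a b)
  (sumOfSquares≤σ₂ (<⇒≤ (<-trans (<-trans 1<a a<b) b<n)) (1<a ∷ a<b ∷ b<n ∷ [-]) (1∣ n ∷ a∣n ∷ b∣n ∷ ∣-refl ∷ []))
  where
  tidy : ∀ n a b → 1 * 1 + (a * a + (b * b + (n * n + 0))) ≡ 1 + a * a + b * b + n * n
  tidy = solve-∀

-- Solutions of σ₂(n) + w² = n² + w n + 5

leastPrimeFactor : ∀ n → 2 ≤ n → ∃ λ p → Prime p × p ∣ n × p Rough n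
leastPrimeFactor n n≥2 = search n 2 ≤-refl (m≤n+m n 2) 2-rough
  where
  instance
    n-nonTrivial : ℕ.NonTrivial n
    n-nonTrivial = ℕ.n>1⇒nonTrivial n≥2
  search : ∀ gap k → 2 ≤ k → n ≤ k + gap → k Rough n → ∃ λ p → Prime p × p ∣ n × p Rough n
  search gap k k≥2 n≤k+gap r with k ∣? n
  ... | yes k∣n = k , rough∧∣⇒prime {{ℕ.n>1⇒nonTrivial k≥2}} r k∣n , k∣n , r
  search zero k k≥2 n≤k+0 r | no k∤n =
    ⊥-elim (k∤n (subst (_∣ n) (≤-antisym (subst (n ≤_) (+-identityʳ k) n≤k+0) (rough⇒≤ r)) ∣-refl))
  search (suc gap) k k≥2 n≤k+gap r | no k∤n =
    search gap (suc k) (≤-trans k≥2 (n≤1+n k)) (subst (n ≤_) (+-suc k gap) n≤k+gap) (∤⇒rough-suc k∤n r)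

rough∧∣⇒≤ : ∀ {p n d} → p Rough n → d ∣ n → 2 ≤ d → p ≤ d
rough∧∣⇒≤ r d∣n d≥2 = rough⇒≤ {{ℕ.n>1⇒nonTrivial d≥2}} (rough∧∣⇒rough r d∣n)

Equation : ℕ → ℕ → Set
Equation w n = σ₂ n + w * w ≡ n * n + w * n + 5

SmallSolution : ℕ → ℕ → Set
SmallSolution w n = n ≤ (w + w * w ∸ 5) ^ 3

MarkovSolution : ℕ → ℕ → Set
MarkovSolution w n = ∃ λ x → ∃ λ y → Prime x × Prime y × x < y × n ≡ x * y × Markov x y w

≤∧≢2⇒≥3 : ∀ {w} → 2 ≤ w → w ≢ 2 → 3 ≤ w
≤∧≢2⇒≥3 w≥2 w≢2 = ≤∧≢⇒< w≥2 (w≢2 ∘ sym)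

smallSolution-cube : ∀ {w n} → 3 ≤ w → n ≤ w ^ 3 → SmallSolution w n
smallSolution-cube {w} w≥3 n≤w³ = ≤-trans n≤w³ (^-monoˡ-≤ 3 w≤w+w²-5)
  where
  w≤w+w²-5 : w ≤ w + w * w ∸ 5
  w≤w+w²-5 = subst (w ≤_) (sym (+-∸-assoc w (≤-trans (s≤s (s≤s (s≤s (s≤s (s≤s z≤n))))) (*-mono-≤ w≥3 w≥3))))
               (m≤m+n w (w * w ∸ 5))

smallSolution-1 : ∀ {w} → 2 ≤ w → SmallSolution w 1
smallSolution-1 {w} w≥2 = ^-monoˡ-≤ 3 (∸-monoˡ-≤ 5 (+-mono-≤ w≥2 (*-mono-≤ w≥2 w≥2)))

≤⇒≤cube : ∀ {w n} → 1 ≤ w → n ≤ w → n ≤ w ^ 3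
≤⇒≤cube {w} w≥1 n≤w = ≤-trans n≤w (m≤m*n w (w ^ 2) {{m^n≢0 w 2 {{ℕ.>-nonZero w≥1}}}})

prime-solution : ∀ {w n} → 2 ≤ w → Prime n → Equation w n → 3 ≤ w × n ≤ w ^ 3
prime-solution {w} {n} w≥2 pn eq = ≤∧≢2⇒≥3 w≥2 w≢2 , ≤⇒≤cube (<⇒≤ w≥2) (<⇒≤ n<w)
  where
  lhs : ∀ n w → 1 + n * n + w * w ≡ n * n + 1 + w * w
  lhs = solve-∀
  rhs : ∀ n w → n * n + w * n + 5 ≡ n * n + 1 + (w * n + 4)
  rhs = solve-∀
  w²≡ : w * w ≡ w * n + 4
  w²≡ = +-cancelˡ-≡ (n * n + 1) _ _ (trans (sym (lhs n w)) (trans (cong (_+ w * w) (sym (σ₂-prime pn))) (trans eq (rhs n w))))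
  w≢2 : w ≢ 2
  w≢2 refl = <⇒≢ (<-trans (s≤s z≤n) (*-monoʳ-< 2 (prime⇒≥2 pn))) (sym (+-cancelʳ-≡ 4 (2 * n) 0 (sym w²≡)))
  n<w : n < w
  n<w = *-cancelˡ-< w n w (subst (w * n <_) (sym w²≡) (m<m+n (w * n) (s≤s z≤n)))

prime²-solution : ∀ {w p} → 2 ≤ w → Prime p → Equation w (p * p) → 3 ≤ w × p * p ≤ w ^ 3
prime²-solution {w} {p} w≥2 pp eq = ≤∧≢2⇒≥3 w≥2 w≢2 , ≤⇒≤cube (<⇒≤ w≥2) P≤w
  where
  P = p * p
  P≥1 : 1 ≤ P
  P≥1 = *-mono-≤ (<⇒≤ (prime⇒≥2 pp)) (<⇒≤ (prime⇒≥2 pp))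
  lhs : ∀ P w → P * P + 1 + (P + w * w) ≡ 1 + P + P * P + w * w
  lhs = solve-∀
  rhs : ∀ P w → P * P + w * P + 5 ≡ P * P + 1 + (w * P + 4)
  rhs = solve-∀
  key : P + w * w ≡ w * P + 4
  key = +-cancelˡ-≡ (P * P + 1) _ _ (trans (lhs P w) (trans (cong (_+ w * w) (sym (σ₂-prime² pp))) (trans eq (rhs P w))))
  w≢2 : w ≢ 2
  w≢2 refl = <⇒≢ P≥1 (+-cancelˡ-≡ P 0 P (+-cancelʳ-≡ 4 _ _ (trans (l₁ P) (trans key (l₂ P)))))
    where
    l₁ : ∀ P → P + 0 + 4 ≡ P + 2 * 2
    l₁ = solve-∀
    l₂ : ∀ P → 2 * P + 4 ≡ P + P + 4
    l₂ = solve-∀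
  w≮P : ∀ {w P} → 1 ≤ w → w < P → P + w * w ≡ w * P + 4 → ⊥
  w≮P {suc w′} {P} _ w<P e = <⇒≱ (s≤s (s≤s z≤n)) (+-cancelˡ-≤ (w′ * w′ + 2 * w′) 4 1 (begin
    w′ * w′ + 2 * w′ + 4   ≡⟨ l₁ w′ ⟩
    w′ * (w′ + 2) + 4      ≤⟨ +-monoˡ-≤ 4 (*-monoʳ-≤ w′ (subst (_≤ P) (+-comm 2 w′) w<P)) ⟩
    w′ * P + 4             ≡⟨ +-cancelˡ-≡ P _ _ (trans (sym (+-assoc P (w′ * P) 4)) (trans (sym e) (l₂ P w′))) ⟩
    w′ * w′ + 2 * w′ + 1   ∎))
    where
    open ≤-Reasoning
    l₁ : ∀ w → w * w + 2 * w + 4 ≡ w * (w + 2) + 4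
    l₁ = solve-∀
    l₂ : ∀ P w → P + suc w * suc w ≡ P + (w * w + 2 * w + 1)
    l₂ = solve-∀
  P≤w : P ≤ w
  P≤w = ≮⇒≥ λ w<P → w≮P (<⇒≤ w≥2) w<P key

cofactor-solution : ∀ {w p b} → 2 ≤ w → Prime p → p Rough (b * p) → p < b → Equation w (b * p) →
                    SmallSolution w (b * p) ⊎ MarkovSolution w (b * p)
cofactor-solution {w} {p} {b} w≥2 pp rough p<b eq = by-compositeness (composite? b)
  where
  n = b * p
  p≥2 = prime⇒≥2 pp
  b≥2 = ≤-trans p≥2 (<⇒≤ p<b)
  b<n : b < n
  b<n = m<m*n b p {{ℕ.>-nonZero (<⇒≤ b≥2)}} p≥2

  -- 1, p, b and n are distinct divisors of n.
  ineq : 1 + p * p + b * b + w * w ≤ w * n + 5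
  ineq = +-cancelˡ-≤ (n * n) _ _ (begin
    n * n + (1 + p * p + b * b + w * w)   ≡⟨ shuffle n p b w ⟩
    1 + p * p + b * b + n * n + w * w     ≤⟨ +-monoˡ-≤ (w * w) (σ₂-≥-four p≥2 p<b b<n (n∣m*n b) (m∣m*n p)) ⟩
    σ₂ n + w * w                          ≡⟨ eq ⟩
    n * n + w * n + 5                     ≡⟨ +-assoc (n * n) (w * n) 5 ⟩
    n * n + (w * n + 5)                   ∎)
    where
    open ≤-Reasoning
    shuffle : ∀ n p b w → n * n + (1 + p * p + b * b + w * w) ≡ 1 + p * p + b * b + n * n + w * w
    shuffle = solve-∀

  markov-pbw : Prime b → Markov p b w
  markov-pbw pb = markov (+-cancelˡ-≡ (n * n + 1) _ _
    (trans (lhs n p b w) (trans (cong (_+ w * w) (sym σ₂n)) (trans eq (rhs n p b w)))))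
    where
    σ₂n : σ₂ n ≡ 1 + p * p + b * b + n * n
    σ₂n = trans (cong σ₂ (*-comm b p)) (trans (σ₂-semiprime pp pb p<b)
            (cong (λ z → 1 + p * p + b * b + z * z) (*-comm p b)))
    lhs : ∀ n p b w → n * n + 1 + (p * p + b * b + w * w) ≡ 1 + p * p + b * b + n * n + w * w
    lhs = solve-∀
    rhs : ∀ n p b w → n * n + w * (b * p) + 5 ≡ n * n + 1 + (p * b * w + 4)
    rhs = solve-∀

  -- A proper factorisation b = e d has both factors ≥ p, so p² ≤ b; with b² ≤ w n from ineq this gives p ≤ w.
  bounded : ∀ {d} → 2 ≤ d → d < b → d ∣ b → n ≤ w ^ 3
  bounded {d} d≥2 d<b d∣b = begin
    b * p           ≤⟨ *-monoˡ-≤ p b≤wp ⟩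
    w * p * p       ≤⟨ *-mono-≤ (*-monoʳ-≤ w p≤w) p≤w ⟩
    w * w * w       ≡⟨ cube w ⟩
    w ^ 3           ∎
    where
    open ≤-Reasoning
    cube : ∀ w → w * w * w ≡ w * (w * (w * 1))
    cube = solve-∀
    e = quotient d∣b
    p*p≤b : p * p ≤ b
    p*p≤b = subst (p * p ≤_) (sym (m∣n⇒n≡quotient*m d∣b))
      (*-mono-≤ (rough∧∣⇒≤ rough (∣-trans (quotient-∣ d∣b) (m∣m*n p)) (quotient>1 d∣b d<b))
                (rough∧∣⇒≤ rough (∣-trans d∣b (m∣m*n p)) d≥2))
    b*b≤w*n : b * b ≤ w * n
    b*b≤w*n = +-cancelʳ-≤ 5 _ _ (begin
      b * b + 5                       ≤⟨ +-monoʳ-≤ (b * b) (s≤s (*-mono-≤ w≥2 w≥2)) ⟩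
      b * b + (1 + w * w)             ≤⟨ m≤n+m _ (p * p) ⟩
      p * p + (b * b + (1 + w * w))   ≡⟨ shuffle p b w ⟩
      1 + p * p + b * b + w * w       ≤⟨ ineq ⟩
      w * n + 5                       ∎)
      where
      shuffle : ∀ p b w → p * p + (b * b + (1 + w * w)) ≡ 1 + p * p + b * b + w * w
      shuffle = solve-∀
    b≤wp : b ≤ w * p
    b≤wp = *-cancelˡ-≤ b {{ℕ.>-nonZero (<⇒≤ b≥2)}} (subst (b * b ≤_) (regroup w b p) b*b≤w*n)
      where
      regroup : ∀ w b p → w * (b * p) ≡ b * (w * p)
      regroup = solve-∀
    p≤w : p ≤ w
    p≤w = *-cancelʳ-≤ p w p {{prime⇒nonZero pp}} (≤-trans p*p≤b b≤wp)

  w≢2 : w ≢ 2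
  w≢2 refl = <⇒≢ p<b (sq+sq≡2*prod⇒≡ p b (≤-antisym (+-cancelʳ-≤ 5 _ _ (begin
    p * p + b * b + 5             ≡⟨ l₁ p b ⟩
    1 + p * p + b * b + 2 * 2     ≤⟨ ineq ⟩
    2 * (b * p) + 5               ≡⟨ l₂ p b ⟩
    2 * p * b + 5                 ∎)) (2*m*n≤m*m+n*n p b)))
    where
    open ≤-Reasoning
    l₁ : ∀ p b → p * p + b * b + 5 ≡ 1 + p * p + b * b + 2 * 2
    l₁ = solve-∀
    l₂ : ∀ p b → 2 * (b * p) + 5 ≡ 2 * p * b + 5
    l₂ = solve-∀

  by-compositeness : Dec (Composite b) → SmallSolution w n ⊎ MarkovSolution w n
  by-compositeness (no b-not-composite) = inj₂ (p , b , pp , pb , p<b , *-comm b p , markov-pbw pb)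
    where
    pb : Prime b
    pb = prime {{ℕ.n>1⇒nonTrivial b≥2}} b-not-composite
  by-compositeness (yes (hasNonTrivialDivisor {d} {{d-nonTrivial}} d<b d∣b)) =
    inj₁ (smallSolution-cube (≤∧≢2⇒≥3 w≥2 w≢2) (bounded (ℕ.nonTrivial⇒n>1 d) d<b d∣b))

solutions : ∀ {w n} → 2 ≤ w → 1 ≤ n → Equation w n → SmallSolution w n ⊎ MarkovSolution w n
solutions {w} {n} w≥2 n≥1 eq with m≤n⇒m<n∨m≡n n≥1
... | inj₂ refl = inj₁ (smallSolution-1 w≥2)
... | inj₁ n≥2 = by-least-factor (leastPrimeFactor n n≥2)
  where
  small : ∀ {m} → 3 ≤ w × m ≤ w ^ 3 → SmallSolution w m ⊎ MarkovSolution w m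
  small (w≥3 , m≤w³) = inj₁ (smallSolution-cube w≥3 m≤w³)
  by-least-factor : (∃ λ p → Prime p × p ∣ n × p Rough n) → SmallSolution w n ⊎ MarkovSolution w n
  by-least-factor (p , pp , divides b n≡bp , rough) = by-cofactor b n≡bp
    where
    by-cofactor : ∀ b → n ≡ b * p → SmallSolution w n ⊎ MarkovSolution w n
    by-cofactor zero n≡0 = ⊥-elim (<⇒≢ n≥1 (sym n≡0))
    by-cofactor (suc zero) n≡1*p = small (prime-solution w≥2 (subst Prime (sym n≡p) pp) eq)
      where
      n≡p : n ≡ p
      n≡p = trans n≡1*p (+-identityʳ p)
    by-cofactor b@(suc (suc _)) n≡bp with m≤n⇒m<n∨m≡n (rough∧∣⇒≤ rough (divides p (trans n≡bp (*-comm b p))) (s≤s (s≤s z≤n)))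
    ... | inj₂ refl = subst (λ m → SmallSolution w m ⊎ MarkovSolution w m) (sym n≡bp)
                        (small (prime²-solution w≥2 pp (subst (Equation w) n≡bp eq)))
    ... | inj₁ p<b = subst (λ m → SmallSolution w m ⊎ MarkovSolution w m) (sym n≡bp)
                        (cofactor-solution w≥2 pp (subst (p Rough_) n≡bp rough) p<b (subst (Equation w) n≡bp eq))

open ℤ using (ℤ; +_; -[1+_])
import Data.Integer.Properties as ℤP
import Data.Integer.Tactic.RingSolver as ℤ-Solver

pos-^ : ∀ a n → + (a ^ n) ≡ (+ a) ℤ.^ n
pos-^ a zero = refl
pos-^ a (suc n) = trans (ℤP.pos-* a (a ^ n)) (cong (λ z → + a ℤ.* z) (pos-^ a n))

V-step : ∀ P n → V P -[1+ 0 ] (suc (suc n)) ≡ P ℤ.* V P -[1+ 0 ] (suc n) ℤ.+ V P -[1+ 0 ] n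
V-step P n = cong (λ z → P ℤ.* V P -[1+ 0 ] (suc n) ℤ.+ z)
  (trans (cong ℤ.-_ (ℤP.-1*i≡-i (V P -[1+ 0 ] n))) (ℤP.neg-involutive (V P -[1+ 0 ] n)))

V-pos : ∀ p n → V (+ p) -[1+ 0 ] n ≡ + Lucas.v p n
V-pos p zero = refl
V-pos p (suc zero) = refl
V-pos p (suc (suc n)) = begin
  V (+ p) -[1+ 0 ] (suc (suc n))                  ≡⟨ V-step (+ p) n ⟩
  + p ℤ.* V (+ p) -[1+ 0 ] (suc n) ℤ.+ V (+ p) -[1+ 0 ] n
    ≡⟨ cong₂ (λ a b → + p ℤ.* a ℤ.+ b) (V-pos p (suc n)) (V-pos p n) ⟩
  + p ℤ.* + v (suc n) ℤ.+ + v n                   ≡⟨ cong (ℤ._+ + v n) (ℤP.pos-* p (v (suc n))) ⟨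
  + (p * v (suc n)) ℤ.+ + v n                     ≡⟨ ℤP.pos-+ (p * v (suc n)) (v n) ⟨
  + v (suc (suc n))                               ∎
  where
  open ≡-Reasoning
  open Lucas p using (v)

sign : ℕ → ℤ
sign zero = ℤ.1ℤ
sign (suc n) = ℤ.- sign n

sign-even : ∀ j → sign (2 * j) ≡ ℤ.1ℤ
sign-even zero = refl
sign-even (suc j) = trans (cong sign (*-suc 2 j)) (trans (ℤP.neg-involutive (sign (2 * j))) (sign-even j))

V-neg : ∀ P n → V (ℤ.- P) -[1+ 0 ] n ≡ sign n ℤ.* V P -[1+ 0 ] n
V-neg P zero = refl
V-neg P (suc zero) = sym (ℤP.-1*i≡-i P)
V-neg P (suc (suc n)) = begin
  V (ℤ.- P) -[1+ 0 ] (suc (suc n))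
    ≡⟨ V-step (ℤ.- P) n ⟩
  ℤ.- P ℤ.* V (ℤ.- P) -[1+ 0 ] (suc n) ℤ.+ V (ℤ.- P) -[1+ 0 ] n
    ≡⟨ cong₂ (λ a b → ℤ.- P ℤ.* a ℤ.+ b) (V-neg P (suc n)) (V-neg P n) ⟩
  ℤ.- P ℤ.* (ℤ.- sign n ℤ.* V P -[1+ 0 ] (suc n)) ℤ.+ sign n ℤ.* V P -[1+ 0 ] n
    ≡⟨ regroup P (sign n) (V P -[1+ 0 ] (suc n)) (V P -[1+ 0 ] n) ⟩
  ℤ.- ℤ.- sign n ℤ.* (P ℤ.* V P -[1+ 0 ] (suc n) ℤ.+ V P -[1+ 0 ] n)
    ≡⟨ cong (λ z → ℤ.- ℤ.- sign n ℤ.* z) (V-step P n) ⟨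
  sign (suc (suc n)) ℤ.* V P -[1+ 0 ] (suc (suc n)) ∎
  where
  open ≡-Reasoning
  regroup : ∀ P s a b → ℤ.- P ℤ.* (ℤ.- s ℤ.* a) ℤ.+ s ℤ.* b ≡ ℤ.- ℤ.- s ℤ.* (P ℤ.* a ℤ.+ b)
  regroup = ℤ-Solver.solve-∀

V-even : ∀ P j → V P -[1+ 0 ] (2 * j) ≡ + Lucas.v ℤ.∣ P ∣ (2 * j)
V-even (+ p) j = V-pos p (2 * j)
V-even -[1+ q ] j = begin
  V (ℤ.- + suc q) -[1+ 0 ] (2 * j)               ≡⟨ V-neg (+ suc q) (2 * j) ⟩
  sign (2 * j) ℤ.* V (+ suc q) -[1+ 0 ] (2 * j)  ≡⟨ cong (λ z → z ℤ.* V (+ suc q) -[1+ 0 ] (2 * j)) (sign-even j) ⟩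
  ℤ.1ℤ ℤ.* V (+ suc q) -[1+ 0 ] (2 * j)          ≡⟨ ℤP.*-identityˡ _ ⟩
  V (+ suc q) -[1+ 0 ] (2 * j)                   ≡⟨ V-pos (suc q) (2 * j) ⟩
  + Lucas.v (suc q) (2 * j)                      ∎
  where open ≡-Reasoning

∣P*P+4∣ : ∀ P → ℤ.∣ P ℤ.* P ℤ.+ + 4 ∣ ≡ ℤ.∣ P ∣ * ℤ.∣ P ∣ + 4
∣P*P+4∣ P = cong ℤ.∣_∣ (trans (cong (λ z → z ℤ.+ + 4) (square P)) (sym (ℤP.pos-+ (ℤ.∣ P ∣ * ℤ.∣ P ∣) 4)))
  where
  square : ∀ P → P ℤ.* P ≡ + (ℤ.∣ P ∣ * ℤ.∣ P ∣)
  square (+ p) = sym (ℤP.pos-* p p)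
  square -[1+ q ] = refl

squareFree-P*P+4 : ∀ {P} → SquareFree (P ℤ.* P ℤ.+ + 4) → SquareFree (+ Lucas.D ℤ.∣ P ∣)
squareFree-P*P+4 {P} sf d h = sf d (subst (d * d ∣_) (sym (∣P*P+4∣ P)) h)

squareFree-p*p+4⇒p≥1 : ∀ {p} → SquareFree (+ Lucas.D p) → 1 ≤ p
squareFree-p*p+4⇒p≥1 {zero} sf with sf 2 (divides 1 refl)
... | ()
squareFree-p*p+4⇒p≥1 {suc p} sf = s≤s z≤n

equation-ℕ : ∀ {s n w} → + s ℤ.- + n ℤ.* + n ≡ + w ℤ.* + n ℤ.- + w ℤ.* + w ℤ.+ + 5 → s + w * w ≡ n * n + w * n + 5
equation-ℕ {s} {n} {w} e = ℤP.+-injective (begin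
  + (s + w * w)                                          ≡⟨ trans (ℤP.pos-+ s (w * w)) (cong (λ z → + s ℤ.+ z) (ℤP.pos-* w w)) ⟩
  + s ℤ.+ + w ℤ.* + w                                    ≡⟨ split (+ s) (+ n ℤ.* + n) (+ w ℤ.* + w) ⟩
  (+ s ℤ.- + n ℤ.* + n) ℤ.+ (+ n ℤ.* + n ℤ.+ + w ℤ.* + w) ≡⟨ cong (λ z → z ℤ.+ (+ n ℤ.* + n ℤ.+ + w ℤ.* + w)) e ⟩
  (+ w ℤ.* + n ℤ.- + w ℤ.* + w ℤ.+ + 5) ℤ.+ (+ n ℤ.* + n ℤ.+ + w ℤ.* + w)
                                                         ≡⟨ merge (+ w ℤ.* + n) (+ w ℤ.* + w) (+ n ℤ.* + n) ⟩
  + n ℤ.* + n ℤ.+ + w ℤ.* + n ℤ.+ + 5                    ≡⟨ cong₂ (λ a b → a ℤ.+ b ℤ.+ + 5) (ℤP.pos-* n n) (ℤP.pos-* w n) ⟨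
  + (n * n) ℤ.+ + (w * n) ℤ.+ + 5                        ≡⟨ cong (λ z → z ℤ.+ + 5) (ℤP.pos-+ (n * n) (w * n)) ⟨
  + (n * n + w * n) ℤ.+ + 5                              ≡⟨ ℤP.pos-+ (n * n + w * n) 5 ⟨
  + (n * n + w * n + 5)                                  ∎)
  where
  open ≡-Reasoning
  split : ∀ a b c → a ℤ.+ c ≡ (a ℤ.- b) ℤ.+ (b ℤ.+ c)
  split = ℤ-Solver.solve-∀
  merge : ∀ a b c → (a ℤ.- b ℤ.+ + 5) ℤ.+ (c ℤ.+ b) ≡ c ℤ.+ a ℤ.+ + 5
  merge = ℤ-Solver.solve-∀

smallSolution-ℤ : ∀ {w n} → 2 ≤ w → SmallSolution w n → + n ℤ.≤ (+ ℤ.∣ + w ∣ ℤ.+ + w ℤ.* + w ℤ.- + 5) ℤ.^ 3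
smallSolution-ℤ {w} {n} w≥2 small = subst (λ z → + n ℤ.≤ z ℤ.^ 3) (sym base) (subst (+ n ℤ.≤_) (pos-^ (w + w * w ∸ 5) 3) (ℤ.+≤+ small))
  where
  base : + w ℤ.+ + w ℤ.* + w ℤ.- + 5 ≡ + (w + w * w ∸ 5)
  base = trans (cong (λ z → z ℤ.- + 5) (sym (trans (ℤP.pos-+ w (w * w)) (cong (λ z → + w ℤ.+ z) (ℤP.pos-* w w)))))
           (trans (ℤP.m-n≡m⊖n (w + w * w) 5) (ℤP.⊖-≥ (≤-trans (n≤1+n 5) (+-mono-≤ w≥2 (*-mono-≤ w≥2 w≥2)))))

module IntegerForms (P : ℤ) where
  open Lucas ℤ.∣ P ∣

  V≡v : ∀ {i} j → i ≡ 2 * j → V P -[1+ 0 ] i ≡ + v i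
  V≡v j refl = V-even P j

  isPrime-V : ∀ {i} j → i ≡ 2 * j → Prime (v i) → IsPrime (V P -[1+ 0 ] i)
  isPrime-V {i} j i≡2j pv = v i , V≡v j i≡2j , pv

  product-V : ∀ {n i i′} j j′ → i ≡ 2 * j → i′ ≡ 2 * j′ → n ≡ v i * v i′ →
              + n ≡ V P -[1+ 0 ] i ℤ.* V P -[1+ 0 ] i′
  product-V {n} {i} {i′} j j′ i≡2j i′≡2j′ n≡ =
    trans (cong +_ n≡) (trans (ℤP.pos-* (v i) (v i′)) (sym (cong₂ ℤ._*_ (V≡v j i≡2j) (V≡v j′ i′≡2j′))))

  lucasProduct-V : ∀ {m n} → LucasProduct m n →
    (Σ ℕ (λ k → (+ n ≡ V P -[1+ 0 ] (2 ℕ.* k) ℤ.* V P -[1+ 0 ] (2 ℕ.* k ℕ.+ 2 ℕ.* m))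
         × IsPrime (V P -[1+ 0 ] (2 ℕ.* k)) × IsPrime (V P -[1+ 0 ] (2 ℕ.* k ℕ.+ 2 ℕ.* m))))
    ⊎ (Σ ℕ (λ k → (2 ℕ.* k ≤ 2 ℕ.* m) × (m ≢ 2 ℕ.* k)
         × (+ n ≡ V P -[1+ 0 ] (2 ℕ.* k) ℤ.* V P -[1+ 0 ] (2 ℕ.* m ℕ.∸ 2 ℕ.* k))
         × IsPrime (V P -[1+ 0 ] (2 ℕ.* k)) × IsPrime (V P -[1+ 0 ] (2 ℕ.* m ℕ.∸ 2 ℕ.* k))))
  lucasProduct-V {m} (inj₁ (k , n≡ , pk , pk+m)) =
    inj₁ (k , product-V k (k + m) refl 2k+2m n≡ , isPrime-V k refl pk , isPrime-V (k + m) 2k+2m pk+m)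
    where
    2k+2m : 2 * k + 2 * m ≡ 2 * (k + m)
    2k+2m = sym (*-distribˡ-+ 2 k m)
  lucasProduct-V {m} (inj₂ (k , 2k≤2m , m≢2k , n≡ , pk , pm-k)) =
    inj₂ (k , 2k≤2m , m≢2k , product-V k (m ∸ k) refl 2m-2k n≡ , isPrime-V k refl pk , isPrime-V (m ∸ k) 2m-2k pm-k)
    where
    2m-2k : 2 * m ∸ 2 * k ≡ 2 * (m ∸ k)
    2m-2k = sym (*-distribˡ-∸ 2 m k)

theorem1p6 : (P : ℤ) → SquareFree (P ℤ.* P ℤ.+ + 4) → (m : ℕ) → (n : ℕ) → 1 ≤ n →
    + σ₂ n ℤ.- + n ℤ.* + n
      ≡ V P -[1+ 0 ] (2 ℕ.* m) ℤ.* + n ℤ.- V P -[1+ 0 ] (2 ℕ.* m) ℤ.* V P -[1+ 0 ] (2 ℕ.* m) ℤ.+ + 5 →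
    (+ n ℤ.≤ (+ ℤ.∣ V P -[1+ 0 ] (2 ℕ.* m) ∣ ℤ.+ V P -[1+ 0 ] (2 ℕ.* m) ℤ.* V P -[1+ 0 ] (2 ℕ.* m) ℤ.- + 5) ℤ.^ 3)
    ⊎ (Σ ℕ (λ k → (+ n ≡ V P -[1+ 0 ] (2 ℕ.* k) ℤ.* V P -[1+ 0 ] (2 ℕ.* k ℕ.+ 2 ℕ.* m))
         × IsPrime (V P -[1+ 0 ] (2 ℕ.* k)) × IsPrime (V P -[1+ 0 ] (2 ℕ.* k ℕ.+ 2 ℕ.* m))))
    ⊎ (Σ ℕ (λ k → (2 ℕ.* k ≤ 2 ℕ.* m) × (m ≢ 2 ℕ.* k)
         × (+ n ≡ V P -[1+ 0 ] (2 ℕ.* k) ℤ.* V P -[1+ 0 ] (2 ℕ.* m ℕ.∸ 2 ℕ.* k))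
         × IsPrime (V P -[1+ 0 ] (2 ℕ.* k)) × IsPrime (V P -[1+ 0 ] (2 ℕ.* m ℕ.∸ 2 ℕ.* k))))
theorem1p6 P sf m n n≥1 eq = [ small-case , inj₂ ∘ IntegerForms.lucasProduct-V P ∘ markov-case ]′ (solutions w≥2 n≥1 eqℕ)
  where
  p = ℤ.∣ P ∣
  open Lucas p using (v; LucasProduct)
  sf′ : SquareFree (+ Lucas.D p)
  sf′ = squareFree-P*P+4 {P} sf
  p≥1 : 1 ≤ p
  p≥1 = squareFree-p*p+4⇒p≥1 sf′
  w = v (2 * m)
  w≥2 : 2 ≤ w
  w≥2 = Lucas.Growth.v-even≥2 p p≥1 m
  V≡w : V P -[1+ 0 ] (2 * m) ≡ + w
  V≡w = V-even P m
  eqℕ : Equation w n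
  eqℕ = equation-ℕ {σ₂ n} {n} {w} (subst (λ z → + σ₂ n ℤ.- + n ℤ.* + n ≡ z ℤ.* + n ℤ.- z ℤ.* z ℤ.+ + 5) V≡w eq)
  small-case = λ (small : SmallSolution w n) →
    inj₁ (subst (λ z → + n ℤ.≤ (+ ℤ.∣ z ∣ ℤ.+ z ℤ.* z ℤ.- + 5) ℤ.^ 3) (sym V≡w) (smallSolution-ℤ w≥2 small))
  markov-case : MarkovSolution w n → LucasProduct m n
  markov-case (x , y , px , py , x<y , n≡xy , M) =
    subst (LucasProduct m) (sym n≡xy) (LucasMarkov.markov-primes⇒lucasProduct p p≥1 sf′ m px py x<y M)
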